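{- Let $X$ be a t-diagram with black points $A_1,\dots,A_{d+3}$ in clockwise order, and let the white point $B$ be adjacent to the side $A_iA_{i+1}$. Then the t-diagrams $X\setminus\{A_i,B\}$ and $X\setminus\{A_{i+1},B\}$ are equivalent by diagonals.
   Context: A t-diagram is a set $X$ of $2d+4$ black and white points in the plane ($d\ge 0$) such that: the points are in general position; exactly $d+3$ of them are black and in convex position; no white point lies outside the convex hull of the black points; every triangle with black vertices contains exactly one white point. Black points are labeled $A_1,\dots,A_{d+3}$ clockwise along the boundary of their convex hull, indices modulo $d+3$; this boundary gives an unoriented cyclic order on black points. A white point is adjacent to the side $A_iA_{i+1}$ if it lies inside both triangles $A_{i-1}A_iA_{i+1}$ and $A_iA_{i+1}A_{i+2}$ (equivalently, it lies inside exactly those triangles with black vertices of the form $A_iA_{i+1}A_j$). Two t-diagrams $X,Y$ are equivalent by diagonals if there is a bijection $\varphi:X\to Y$ that preserves colors, preserves the unoriented cyclic order of black points, and such that a white point $B$ lies in the convex hull of a set of cyclically consecutive black points $\{A_i\}$ of $X$ iff $\varphi(B)$ lies in the convex hull of $\{\varphi(A_i)\}$ in $Y$. -}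

module Defs where

open import Level using (Level; _⊔_) renaming (suc to lsuc)
open import Algebra.Bundles using (CommutativeRing)
open import Data.Nat as ℕ using (ℕ; zero; suc)
open import Data.Nat.DivMod using (_mod_)
open import Data.Fin as Fin using (Fin; toℕ; punchIn)
open import Data.Product using (Σ; ∃; _×_; _,_)
open import Data.Sum using (_⊎_)
open import Relation.Binary.Core using (Rel)
open import Relation.Binary.Structures using (IsStrictTotalOrder)
open import Relation.Binary.PropositionalEquality using (_≡_; _≢_)
open import Relation.Nullary using (¬_)
open import Function.Bundles using (_↔_; Inverse)

record OrderedField (c ℓ : Level) : Set (lsuc (c ⊔ ℓ)) where
  field
    commutativeRing : CommutativeRing c ℓ
  open CommutativeRing commutativeRing public
  infix 4 _<_
  field
    _<_                : Rel Carrier ℓ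
    isStrictTotalOrder : IsStrictTotalOrder _≈_ _<_
    +-mono-<           : ∀ {x y} z → x < y → x + z < y + z
    *-pos              : ∀ {x y} → 0# < x → 0# < y → 0# < x * y
    0<1                : 0# < 1#
    inverse            : ∀ x → ¬ (x ≈ 0#) → Σ Carrier (λ y → x * y ≈ 1#)

  infix 4 _≤_
  _≤_ : Rel Carrier ℓ
  x ≤ y = (x < y) ⊎ (x ≈ y)

next : ∀ {k} → Fin (suc k) → Fin (suc k)
next {k} i = suc (toℕ i) mod suc k

prev : ∀ {k} → Fin (suc k) → Fin (suc k)
prev {k} i = (toℕ i ℕ.+ k) mod suc k

consec : ∀ {k} → Fin (suc k) → (l : ℕ) → Fin l → Fin (suc k)
consec {k} s l t = (toℕ s ℕ.+ toℕ t) mod suc k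

module Geometry {c ℓ : Level} (F : OrderedField c ℓ) where
  open OrderedField F

  Point : Set c
  Point = Carrier × Carrier

  px py : Point → Carrier
  px (x , _) = x
  py (_ , y) = y

  -- twice the signed area of PQR; negative = clockwise
  det : Point → Point → Point → Carrier
  det P Q R = (px Q - px P) * (py R - py P) - (py Q - py P) * (px R - px P)

  sumF : ∀ {k} → (Fin k → Carrier) → Carrier
  sumF {zero}  f = 0#
  sumF {suc k} f = f Fin.zero + sumF (λ j → f (Fin.suc j))

  InHull : ∀ {k} → (Fin k → Point) → Point → Set (c ⊔ ℓ)
  InHull {k} Q P =
    Σ (Fin k → Carrier) λ w →
      (∀ j → 0# ≤ w j) × (sumF w ≈ 1#)
      × (sumF (λ j → w j * px (Q j)) ≈ px P)
      × (sumF (λ j → w j * py (Q j)) ≈ py P)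

  tri : Point → Point → Point → Fin 3 → Point
  tri A B C Fin.zero = A
  tri A B C (Fin.suc Fin.zero) = B
  tri A B C (Fin.suc (Fin.suc Fin.zero)) = C

  InTriangle : Point → Point → Point → Point → Set (c ⊔ ℓ)
  InTriangle A B C P = InHull (tri A B C) P

  -- A t-diagram with d+3 black points A (labelled clockwise along the
  -- boundary of their convex hull) and d+1 white points W.
  record TDiagram (d : ℕ) (A : Fin (3 ℕ.+ d) → Point) (W : Fin (1 ℕ.+ d) → Point)
         : Set (c ⊔ ℓ) where
    field
      generalPosition :
        let pt : Fin (3 ℕ.+ d) ⊎ Fin (1 ℕ.+ d) → Point
            pt = Data.Sum.[ A , W ]
        in ∀ p q r → p ≢ q → q ≢ r → p ≢ r → ¬ (det (pt p) (pt q) (pt r) ≈ 0#)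
      clockwiseConvex : ∀ (i j k : Fin (3 ℕ.+ d)) → i Fin.< j → j Fin.< k →
                        det (A i) (A j) (A k) < 0#
      whiteInside : ∀ b → InHull A (W b)
      uniqueWhite : ∀ (i j k : Fin (3 ℕ.+ d)) → i ≢ j → j ≢ k → i ≢ k →
        Σ (Fin (1 ℕ.+ d)) λ b → InTriangle (A i) (A j) (A k) (W b)
          × (∀ b′ → InTriangle (A i) (A j) (A k) (W b′) → b′ ≡ b)

  AdjacentToSide : ∀ {k} → (Fin (suc k) → Point) → Point → Fin (suc k) → Set (c ⊔ ℓ)
  AdjacentToSide A B i =
    InTriangle (A (prev i)) (A i) (A (next i)) B
    × InTriangle (A i) (A (next i)) (A (next (next i))) B

  EquivByDiagonals : ∀ {k m} → (A : Fin (suc k) → Point) (W : Fin m → Point)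
                              (A′ : Fin (suc k) → Point) (W′ : Fin m → Point)
                              → Set (c ⊔ ℓ)
  EquivByDiagonals {k} {m} A W A′ W′ =
    Σ (Fin (suc k) ↔ Fin (suc k)) λ σ →
    Σ (Fin m ↔ Fin m) λ τ →
      -- σ preserves the unoriented cyclic order of black points
      ((∀ i → Inverse.to σ (next i) ≡ next (Inverse.to σ i))
        ⊎ (∀ i → Inverse.to σ (next i) ≡ prev (Inverse.to σ i)))
      × (∀ (s : Fin (suc k)) (l : ℕ) → l ℕ.≤ suc k → ∀ (b : Fin m) →
           (InHull (λ t → A (consec s l t)) (W b)
              → InHull (λ t → A′ (Inverse.to σ (consec s l t))) (W′ (Inverse.to τ b)))
         × (InHull (λ t → A′ (Inverse.to σ (consec s l t))) (W′ (Inverse.to τ b))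
              → InHull (λ t → A (consec s l t)) (W b)))

-- Let p = i + 1.  Identify the black points of X ∖ {A_p, B} with those of
-- X ∖ {A_i, B} by letting A_i take the place of A_p; on indices this is a
-- cyclic rotation σ, and the white points are matched identically.  It
-- remains to show, for every white point B′ ≠ B and every set S of
-- cyclically consecutive black points avoiding A_i, that B′ ∈ conv S iff
-- B′ ∈ conv S[A_p := A_i].  A set of at most two black points contains no
-- white point (general position).  Otherwise B′ lies in a triangle of
-- vertices of the convex polygon S (fan triangulation).  If A_p is one of its
-- vertices, say A_p A_y A_z, then A_i A_p A_y A_z is a convex quadrilateral
-- and A_p A_y A_z ⊆ A_i A_p A_y ∪ A_i A_y A_z.  Adjacency puts B into every
-- triangle A_i A_p A_y, which hence contains no other white point, so
-- B′ ∈ A_i A_y A_z.  The converse direction is symmetric.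
module Submission where

open import Defs
open import Level using (Level)
open import Algebra.Bundles using (CommutativeRing)
open import Data.Nat as ℕ using (ℕ; suc)
open import Data.Fin using (Fin)
-- Every
-- commutative ring R receives the homomorphism ℤ → R, n ↦ n·1, so the
-- solver applies to an arbitrary commutative ring with integer constants;
-- this is how all polynomial identities below are discharged.
module IntegerRingSolver {c ℓ : Level} (R : CommutativeRing c ℓ) where
  open import Algebra.Bundles using (RawRing)
  open import Data.Nat as ℕ using (ℕ; zero; suc)
  import Data.Nat.Properties as ℕₚ
  open import Data.Integer as ℤ using (ℤ; +_; -[1+_])
  import Data.Integer.Properties as ℤₚ
  open import Data.Sign as Sign using (Sign)
  open import Data.Maybe using (Maybe; just; nothing)
  open import Relation.Nullary using (yes; no)
  import Relation.Binary.PropositionalEquality as ≡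
  open import Algebra.Solver.Ring.AlmostCommutativeRing
  open CommutativeRing R
  open import Algebra.Properties.Ring ring
  open import Algebra.Properties.Semiring.Mult semiring using (_×_; ×1-homo-*)
  open import Algebra.Properties.Monoid.Mult +-monoid using (×-homo-+)
  open import Relation.Binary.Reasoning.Setoid setoid

  ⟦_⟧ℤ : ℤ → Carrier
  ⟦ + n ⟧ℤ      = n × 1#
  ⟦ -[1+ n ] ⟧ℤ = - (suc n × 1#)

  ⟦_⟧sign : Sign → Carrier
  ⟦ Sign.+ ⟧sign = 1#
  ⟦ Sign.- ⟧sign = - 1#

  -- (1 + m) - (1 + n) = m - n, the step of the recursion for _⊖_
  suc-sub : ∀ (m n : Carrier) → m - n ≈ (1# + m) - (1# + n)
  suc-sub m n = begin
    m - n                 ≈⟨ +-identityˡ _ ⟨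
    0# + (m - n)          ≈⟨ +-congʳ (-‿inverseʳ 1#) ⟨
    (1# - 1#) + (m - n)   ≈⟨ +-assoc _ _ _ ⟩
    1# + (- 1# + (m - n)) ≈⟨ +-congˡ (+-assoc _ _ _) ⟨
    1# + ((- 1# + m) - n) ≈⟨ +-congˡ (+-congʳ (+-comm _ _)) ⟩
    1# + ((m - 1#) - n)   ≈⟨ +-congˡ (+-assoc _ _ _) ⟩
    1# + (m + (- 1# - n)) ≈⟨ +-congˡ (+-congˡ (-‿+-comm 1# n)) ⟩
    1# + (m - (1# + n))   ≈⟨ +-assoc _ _ _ ⟨
    (1# + m) - (1# + n)   ∎

  ⊖-homo : ∀ m n → ⟦ m ℤ.⊖ n ⟧ℤ ≈ m × 1# - n × 1#
  ⊖-homo m zero = begin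
    ⟦ m ℤ.⊖ 0 ⟧ℤ ≈⟨ reflexive (≡.cong ⟦_⟧ℤ (ℤₚ.⊖-≥ {m} {0} ℕ.z≤n)) ⟩
    m × 1#       ≈⟨ +-identityʳ _ ⟨
    m × 1# + 0#  ≈⟨ +-congˡ -0#≈0# ⟨
    m × 1# - 0#  ∎
  ⊖-homo zero (suc n) = sym (+-identityˡ _)
  ⊖-homo (suc m) (suc n) = begin
    ⟦ suc m ℤ.⊖ suc n ⟧ℤ ≈⟨ reflexive (≡.cong ⟦_⟧ℤ (ℤₚ.[1+m]⊖[1+n]≡m⊖n m n)) ⟩
    ⟦ m ℤ.⊖ n ⟧ℤ         ≈⟨ ⊖-homo m n ⟩
    m × 1# - n × 1#      ≈⟨ suc-sub _ _ ⟩
    (1# + m × 1#) - (1# + n × 1#) ∎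

  neg-homo : ∀ i → ⟦ ℤ.- i ⟧ℤ ≈ - ⟦ i ⟧ℤ
  neg-homo -[1+ n ]    = sym (-‿involutive _)
  neg-homo (+ zero)    = sym -0#≈0#
  neg-homo (+ suc n)   = refl

  +-homo : ∀ i j → ⟦ i ℤ.+ j ⟧ℤ ≈ ⟦ i ⟧ℤ + ⟦ j ⟧ℤ
  +-homo -[1+ m ] -[1+ n ] = begin
    - (suc (suc (m ℕ.+ n)) × 1#)   ≈⟨ -‿cong (reflexive (≡.cong (λ k → suc k × 1#) (≡.sym (ℕₚ.+-suc m n)))) ⟩
    - (suc m ℕ.+ suc n) × 1#       ≈⟨ -‿cong (×-homo-+ 1# (suc m) (suc n)) ⟩
    - (suc m × 1# + suc n × 1#)    ≈⟨ -‿+-comm _ _ ⟨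
    - (suc m × 1#) + - (suc n × 1#) ∎
  +-homo -[1+ m ] (+ n)    = trans (⊖-homo n (suc m)) (+-comm _ _)
  +-homo (+ m) -[1+ n ]    = ⊖-homo m (suc n)
  +-homo (+ m) (+ n)       = ×-homo-+ 1# m n

  ◃-homo : ∀ s n → ⟦ s ℤ.◃ n ⟧ℤ ≈ ⟦ s ⟧sign * (n × 1#)
  ◃-homo s zero              = sym (zeroʳ _)
  ◃-homo Sign.+ (suc n)      = sym (*-identityˡ _)
  ◃-homo Sign.- (suc n)      = sym (-1*x≈-x _)

  sign-abs-homo : ∀ i → ⟦ i ⟧ℤ ≈ ⟦ ℤ.sign i ⟧sign * (ℤ.∣ i ∣ × 1#)
  sign-abs-homo -[1+ n ]  = ◃-homo Sign.- (suc n)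
  sign-abs-homo (+ zero)  = sym (zeroʳ _)
  sign-abs-homo (+ suc n) = sym (*-identityˡ _)

  sign-*-homo : ∀ s t → ⟦ s Sign.* t ⟧sign ≈ ⟦ s ⟧sign * ⟦ t ⟧sign
  sign-*-homo Sign.- Sign.- = sym (trans (-1*x≈-x _) (-‿involutive _))
  sign-*-homo Sign.- Sign.+ = sym (*-identityʳ _)
  sign-*-homo Sign.+ Sign.- = sym (*-identityˡ _)
  sign-*-homo Sign.+ Sign.+ = sym (*-identityˡ _)

  *-homo : ∀ i j → ⟦ i ℤ.* j ⟧ℤ ≈ ⟦ i ⟧ℤ * ⟦ j ⟧ℤ
  *-homo i j = begin
    ⟦ i ℤ.* j ⟧ℤ                       ≈⟨ ◃-homo (si Sign.* sj) (ai ℕ.* aj) ⟩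
    ⟦ si Sign.* sj ⟧sign * ((ai ℕ.* aj) × 1#)
                                        ≈⟨ *-cong (sign-*-homo si sj) (×1-homo-* ai aj) ⟩
    (s * t) * (a * b)                   ≈⟨ *-assoc _ _ _ ⟩
    s * (t * (a * b))                   ≈⟨ *-congˡ (*-assoc _ _ _) ⟨
    s * ((t * a) * b)                   ≈⟨ *-congˡ (*-congʳ (*-comm _ _)) ⟩
    s * ((a * t) * b)                   ≈⟨ *-congˡ (*-assoc _ _ _) ⟩
    s * (a * (t * b))                   ≈⟨ *-assoc _ _ _ ⟨
    (s * a) * (t * b)                   ≈⟨ *-cong (sign-abs-homo i) (sign-abs-homo j) ⟨
    ⟦ i ⟧ℤ * ⟦ j ⟧ℤ                    ∎
    where
    si = ℤ.sign i
    sj = ℤ.sign j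
    ai = ℤ.∣ i ∣
    aj = ℤ.∣ j ∣
    s = ⟦ si ⟧sign
    t = ⟦ sj ⟧sign
    a = ai × 1#
    b = aj × 1#

  ℤ-rawRing : RawRing _ _
  ℤ-rawRing = record
    { Carrier = ℤ ; _≈_ = ≡._≡_ ; _+_ = ℤ._+_ ; _*_ = ℤ._*_ ; -_ = ℤ.-_ ; 0# = + 0 ; 1# = + 1 }

  ℤ⟶R : ℤ-rawRing -Raw-AlmostCommutative⟶ fromCommutativeRing R
  ℤ⟶R = record
    { ⟦_⟧ = ⟦_⟧ℤ ; +-homo = +-homo ; *-homo = *-homo ; -‿homo = neg-homo
    ; 0-homo = refl ; 1-homo = +-identityʳ 1# }

  ℤ-equal? : ∀ m n → Maybe (⟦ m ⟧ℤ ≈ ⟦ n ⟧ℤ)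
  ℤ-equal? m n with m ℤ.≟ n
  ... | yes ≡.refl = just refl
  ... | no _       = nothing

  open import Algebra.Solver.Ring ℤ-rawRing (fromCommutativeRing R) ℤ⟶R ℤ-equal? public

module OrderedFieldSigns {c ℓ : Level} (F : OrderedField c ℓ) where
  open import Data.Sum using (inj₁; inj₂)
  open import Data.Empty using (⊥-elim)
  open import Relation.Nullary using (¬_)
  open import Relation.Binary.Definitions using (tri<; tri≈; tri>)
  open import Relation.Binary.Structures using (IsStrictTotalOrder)
  open OrderedField F
  open IntegerRingSolver commutativeRing using (solve; _:=_; _:*_; :-_)
  open IsStrictTotalOrder isStrictTotalOrder public
    using (compare; irrefl; asym; <-respʳ-≈; <-respˡ-≈) renaming (trans to <-trans)

  0≉1 : ¬ (0# ≈ 1#)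
  0≉1 e = irrefl e 0<1

  <0⇒0<- : ∀ {x} → x < 0# → 0# < - x
  <0⇒0<- {x} h = <-respʳ-≈ (+-identityˡ (- x)) (<-respˡ-≈ (-‿inverseʳ x) (+-mono-< (- x) h))

  0<⇒-<0 : ∀ {x} → 0# < x → - x < 0#
  0<⇒-<0 {x} h = <-respʳ-≈ (-‿inverseʳ x) (<-respˡ-≈ (+-identityˡ (- x)) (+-mono-< (- x) h))

  0<-⇒<0 : ∀ {x} → 0# < - x → x < 0#
  0<-⇒<0 {x} h = <-respˡ-≈ (solve 1 (λ x → :- (:- x) := x) refl x) (0<⇒-<0 h)

  <0⇒≉0 : ∀ {x} → x < 0# → ¬ (x ≈ 0#)
  <0⇒≉0 h e = irrefl e h

  ≤0-resp-≈ : ∀ {x y} → x ≈ y → x ≤ 0# → y ≤ 0#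
  ≤0-resp-≈ e (inj₁ h) = inj₁ (<-respˡ-≈ e h)
  ≤0-resp-≈ e (inj₂ h) = inj₂ (trans (sym e) h)

  0≤-resp-≈ : ∀ {x y} → x ≈ y → 0# ≤ x → 0# ≤ y
  0≤-resp-≈ e (inj₁ h) = inj₁ (<-respʳ-≈ e h)
  0≤-resp-≈ e (inj₂ h) = inj₂ (trans h e)

  0<⇒-≤0 : ∀ {x} → 0# < x → - x ≤ 0#
  0<⇒-≤0 h = inj₁ (0<⇒-<0 h)

  0≤×≤0 : ∀ {x y} → 0# ≤ x → y ≤ 0# → x * y ≤ 0#
  0≤×≤0 {x} {y} (inj₂ e) _ = inj₂ (trans (*-congʳ (sym e)) (zeroˡ y))
  0≤×≤0 {x} {y} (inj₁ _) (inj₂ e) = inj₂ (trans (*-congˡ e) (zeroʳ x))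
  0≤×≤0 {x} {y} (inj₁ hx) (inj₁ hy) = inj₁ (0<-⇒<0 (<-respʳ-≈
    (solve 2 (λ x y → x :* (:- y) := :- (x :* y)) refl x y) (*-pos hx (<0⇒0<- hy))))

  0≤×0≤ : ∀ {x y} → 0# ≤ x → 0# ≤ y → 0# ≤ x * y
  0≤×0≤ {x} {y} (inj₂ e) _ = inj₂ (trans (sym (zeroˡ y)) (*-congʳ e))
  0≤×0≤ {x} {y} (inj₁ _) (inj₂ e) = inj₂ (trans (sym (zeroʳ x)) (*-congˡ e))
  0≤×0≤ (inj₁ hx) (inj₁ hy) = inj₁ (*-pos hx hy)

  ≤0×<0 : ∀ {x y} → x ≤ 0# → y < 0# → 0# ≤ x * y
  ≤0×<0 {x} {y} (inj₂ e) _ = inj₂ (trans (sym (zeroˡ y)) (*-congʳ (sym e)))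
  ≤0×<0 {x} {y} (inj₁ hx) hy = inj₁ (<-respʳ-≈
    (solve 2 (λ x y → (:- x) :* (:- y) := x :* y) refl x y) (*-pos (<0⇒0<- hx) (<0⇒0<- hy)))

  ≤0+≤0 : ∀ {x y} → x ≤ 0# → y ≤ 0# → x + y ≤ 0#
  ≤0+≤0 {x} {y} (inj₂ e) hy = ≤0-resp-≈ (trans (sym (+-identityˡ y)) (+-congʳ (sym e))) hy
  ≤0+≤0 {x} {y} (inj₁ hx) (inj₂ e) = inj₁ (<-respˡ-≈ (trans (sym (+-identityʳ x)) (+-congˡ (sym e))) hx)
  ≤0+≤0 {x} {y} (inj₁ hx) (inj₁ hy) = inj₁ (<-trans (<-respʳ-≈ (+-identityˡ y) (+-mono-< y hx)) hy)

  0≤+0≤ : ∀ {x y} → 0# ≤ x → 0# ≤ y → 0# ≤ x + y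
  0≤+0≤ {x} {y} (inj₂ e) hy = 0≤-resp-≈ (trans (sym (+-identityˡ y)) (+-congʳ e)) hy
  0≤+0≤ {x} {y} (inj₁ hx) (inj₂ e) = inj₁ (<-respʳ-≈ (trans (sym (+-identityʳ x)) (+-congˡ e)) hx)
  0≤+0≤ {x} {y} (inj₁ hx) (inj₁ hy) = inj₁ (<-trans hy (<-respˡ-≈ (+-identityˡ y) (+-mono-< y hx)))

  inverse-<0 : ∀ {x y} → x < 0# → x * y ≈ 1# → y < 0#
  inverse-<0 {x} {y} hx e with compare y 0#
  ... | tri< y<0 _ _ = y<0
  ... | tri≈ _ y≈0 _ = ⊥-elim (0≉1 (trans (trans (sym (zeroʳ x)) (*-congˡ (sym y≈0))) e))
  ... | tri> _ _ 0<y = ⊥-elim (asym (0<⇒-<0 0<1) (<-respʳ-≈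
          (trans (solve 2 (λ x y → (:- x) :* y := :- (x :* y)) refl x y) (-‿cong e))
          (*-pos (<0⇒0<- hx) 0<y)))

-- Orientation is affine in Z, hence inherited by convex
-- combinations; conversely a point to the right of the three sides of a
-- clockwise triangle lies in it (barycentric coordinates by Cramer's rule);
-- and a point of the hull of a clockwise convex polygon lies in a triangle
-- spanned by three of its vertices (fan triangulation).
module PlaneGeometry {c ℓ : Level} (F : OrderedField c ℓ) where
  open import Level using (_⊔_)
  open import Data.Nat as ℕ using (ℕ; zero; suc)
  import Data.Nat.Properties as ℕₚ
  open import Data.Fin as Fin using (Fin)
  import Data.Fin.Properties as Finₚ
  open import Data.Product using (_,_; proj₁)
  open import Data.Sum using (_⊎_; inj₁; inj₂)
  open import Data.Empty using (⊥-elim)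
  open import Relation.Nullary using (¬_)
  open import Relation.Binary.Definitions using (tri<; tri≈; tri>)
  import Relation.Binary.PropositionalEquality as ≡
  open import Data.Integer using (+_)
  open OrderedField F
  open Geometry F
  open OrderedFieldSigns F
  open IntegerRingSolver commutativeRing using (solve; _:=_; _:+_; _:*_; _:-_; :-_; con)
  open import Relation.Binary.Reasoning.Setoid setoid

  sumF-cong : ∀ {k} {f g : Fin k → Carrier} → (∀ j → f j ≈ g j) → sumF f ≈ sumF g
  sumF-cong {zero}  h = refl
  sumF-cong {suc k} h = +-cong (h Fin.zero) (sumF-cong (λ j → h (Fin.suc j)))

  sumF-≈0 : ∀ {k} {f : Fin k → Carrier} → (∀ j → f j ≈ 0#) → sumF f ≈ 0#
  sumF-≈0 {zero}  h = refl
  sumF-≈0 {suc k} h = trans (+-cong (h Fin.zero) (sumF-≈0 (λ j → h (Fin.suc j)))) (+-identityˡ 0#)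

  sumF-≤0 : ∀ {k} {f : Fin k → Carrier} → (∀ j → f j ≤ 0#) → sumF f ≤ 0#
  sumF-≤0 {zero}  h = inj₂ refl
  sumF-≤0 {suc k} h = ≤0+≤0 (h Fin.zero) (sumF-≤0 (λ j → h (Fin.suc j)))

  sumF-+ : ∀ {k} (f g : Fin k → Carrier) → sumF (λ j → f j + g j) ≈ sumF f + sumF g
  sumF-+ {zero}  f g = sym (+-identityˡ 0#)
  sumF-+ {suc k} f g = trans (+-congˡ (sumF-+ (λ j → f (Fin.suc j)) (λ j → g (Fin.suc j))))
    (solve 4 (λ a b c d → (a :+ b) :+ (c :+ d) := (a :+ c) :+ (b :+ d)) refl _ _ _ _)

  sumF-* : ∀ {k} (a : Carrier) (f : Fin k → Carrier) → sumF (λ j → a * f j) ≈ a * sumF f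
  sumF-* {zero}  a f = sym (zeroʳ a)
  sumF-* {suc k} a f = trans (+-congˡ (sumF-* a (λ j → f (Fin.suc j))))
    (solve 3 (λ a b c → a :* b :+ a :* c := a :* (b :+ c)) refl _ _ _)

  sumF-affine : ∀ {k} (w x y : Fin k → Carrier) (α β κ : Carrier) →
    sumF (λ j → w j * (α * y j + β * x j + κ))
      ≈ α * sumF (λ j → w j * y j) + β * sumF (λ j → w j * x j) + κ * sumF w
  sumF-affine {zero} w x y α β κ =
    solve 3 (λ α β κ → con (+ 0) := α :* con (+ 0) :+ β :* con (+ 0) :+ κ :* con (+ 0)) refl α β κ
  sumF-affine {suc k} w x y α β κ =
    trans (+-congˡ (sumF-affine (λ j → w (Fin.suc j)) (λ j → x (Fin.suc j)) (λ j → y (Fin.suc j)) α β κ))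
      (solve 9 (λ w₀ x₀ y₀ α β κ Sy Sx Sw →
          w₀ :* (α :* y₀ :+ β :* x₀ :+ κ) :+ (α :* Sy :+ β :* Sx :+ κ :* Sw)
          := α :* (w₀ :* y₀ :+ Sy) :+ β :* (w₀ :* x₀ :+ Sx) :+ κ :* (w₀ :+ Sw)) refl
          (w Fin.zero) (x Fin.zero) (y Fin.zero) α β κ _ _ _)

  δ : ∀ {k} → Fin k → Fin k → Carrier
  δ Fin.zero    Fin.zero    = 1#
  δ Fin.zero    (Fin.suc _) = 0#
  δ (Fin.suc _) Fin.zero    = 0#
  δ (Fin.suc a) (Fin.suc b) = δ a b

  δ≥0 : ∀ {k} (a b : Fin k) → 0# ≤ δ a b
  δ≥0 Fin.zero    Fin.zero    = inj₁ 0<1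
  δ≥0 Fin.zero    (Fin.suc _) = inj₂ refl
  δ≥0 (Fin.suc _) Fin.zero    = inj₂ refl
  δ≥0 (Fin.suc a) (Fin.suc b) = δ≥0 a b

  sumF-δ : ∀ {k} (a : Fin k) (h : Fin k → Carrier) → sumF (λ t → δ a t * h t) ≈ h a
  sumF-δ {suc k} Fin.zero h =
    trans (+-cong (*-identityˡ _) (sumF-≈0 {k} {λ j → δ Fin.zero (Fin.suc j) * h (Fin.suc j)} (λ j → zeroˡ _)))
          (+-identityʳ _)
  sumF-δ {suc k} (Fin.suc a) h =
    trans (+-cong (zeroˡ _) (sumF-δ a (λ j → h (Fin.suc j)))) (+-identityˡ _)

  det-rotate : ∀ P Q R → det P Q R ≈ det Q R P
  det-rotate (a , b) (c , d) (e , f) =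
    solve 6 (λ a b c d e f → ((c :- a) :* (f :- b)) :- ((d :- b) :* (e :- a))
                       := ((e :- c) :* (b :- d)) :- ((f :- d) :* (a :- c))) refl a b c d e f

  det-swap : ∀ P Q R → det Q P R ≈ - det P Q R
  det-swap (a , b) (c , d) (e , f) =
    solve 6 (λ a b c d e f → ((a :- c) :* (f :- d)) :- ((b :- d) :* (e :- c))
                       := :- (((c :- a) :* (f :- b)) :- ((d :- b) :* (e :- a)))) refl a b c d e f

  det-PQP : ∀ P Q → det P Q P ≈ 0#
  det-PQP (a , b) (c , d) =
    solve 4 (λ a b c d → ((c :- a) :* (b :- b)) :- ((d :- b) :* (a :- a)) := con (+ 0)) refl a b c d

  det-PQQ : ∀ P Q → det P Q Q ≈ 0#
  det-PQQ (a , b) (c , d) =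
    solve 4 (λ a b c d → ((c :- a) :* (d :- b)) :- ((d :- b) :* (c :- a)) := con (+ 0)) refl a b c d

  det-affine : ∀ P Q R → det P Q R ≈
    (px Q - px P) * py R + (- (py Q - py P)) * px R + ((py Q - py P) * px P - (px Q - px P) * py P)
  det-affine (a , b) (c , d) (e , f) =
    solve 6 (λ a b c d e f → ((c :- a) :* (f :- b)) :- ((d :- b) :* (e :- a))
       := (c :- a) :* f :+ (:- (d :- b)) :* e :+ ((d :- b) :* a :- (c :- a) :* b)) refl a b c d e f

  rotate-< : ∀ {P Q R} → det P Q R < 0# → det Q R P < 0#
  rotate-< {P} {Q} {R} h = <-respˡ-≈ (det-rotate P Q R) h

  rotate²-< : ∀ {P Q R} → det P Q R < 0# → det R P Q < 0#
  rotate²-< h = rotate-< (rotate-< h)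

  -- Z lies weakly to the right of the directed line PQ
  RightOf : Point → Point → Point → Set ℓ
  RightOf P Q Z = det P Q Z ≤ 0#

  left⇒right-of-reverse : ∀ {P Q Z} → 0# < det P Q Z → RightOf Q P Z
  left⇒right-of-reverse {P} {Q} {Z} h = ≤0-resp-≈ (sym (det-swap P Q Z)) (0<⇒-≤0 h)

  PQP-right : ∀ P Q → RightOf P Q P
  PQP-right P Q = inj₂ (det-PQP P Q)

  PQQ-right : ∀ P Q → RightOf P Q Q
  PQQ-right P Q = inj₂ (det-PQQ P Q)

  det-of-hull : ∀ {k} {R : Fin k → Point} {Z : Point} (P Q : Point) → (h : InHull R Z) →
    det P Q Z ≈ sumF (λ j → proj₁ h j * det P Q (R j))
  det-of-hull {R = R} {Z} P Q (w , _ , Σw≈1 , Σx≈ , Σy≈) = begin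
    det P Q Z                                     ≈⟨ det-affine P Q Z ⟩
    α * py Z + β * px Z + κ                       ≈⟨ +-cong (+-cong (*-congˡ (sym Σy≈)) (*-congˡ (sym Σx≈)))
                                                            (sym (trans (*-congˡ Σw≈1) (*-identityʳ κ))) ⟩
    α * sumF (λ j → w j * py (R j)) + β * sumF (λ j → w j * px (R j)) + κ * sumF w
                                                  ≈⟨ sumF-affine w (λ j → px (R j)) (λ j → py (R j)) α β κ ⟨
    sumF (λ j → w j * (α * py (R j) + β * px (R j) + κ))
                                                  ≈⟨ sumF-cong (λ j → *-congˡ (sym (det-affine P Q (R j)))) ⟩
    sumF (λ j → w j * det P Q (R j))              ∎
    where
    α = px Q - px P
    β = - (py Q - py P)
    κ = (py Q - py P) * px P - (px Q - px P) * py P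

  hull-right-of : ∀ {k} {R : Fin k → Point} {Z : Point} (P Q : Point) → InHull R Z →
    (∀ j → RightOf P Q (R j)) → RightOf P Q Z
  hull-right-of P Q h@(w , w≥0 , _) hR =
    ≤0-resp-≈ (sym (det-of-hull P Q h)) (sumF-≤0 (λ j → 0≤×≤0 (w≥0 j) (hR j)))

  triangle-right-of : ∀ {X Y Z P} (U V : Point) → InTriangle X Y Z P →
    RightOf U V X → RightOf U V Y → RightOf U V Z → RightOf U V P
  triangle-right-of {X} {Y} {Z} U V h hX hY hZ = hull-right-of {R = tri X Y Z} U V h
    λ { Fin.zero → hX ; (Fin.suc Fin.zero) → hY ; (Fin.suc (Fin.suc Fin.zero)) → hZ }

  hull-on-line : ∀ {k} {R : Fin k → Point} {Z : Point} (P Q : Point) → InHull R Z →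
    (∀ j → det P Q (R j) ≈ 0#) → det P Q Z ≈ 0#
  hull-on-line P Q h hR = trans (det-of-hull P Q h) (sumF-≈0 (λ j → trans (*-congˡ (hR j)) (zeroʳ _)))

  empty-hull : ∀ {R : Fin 0 → Point} {Z : Point} → ¬ InHull R Z
  empty-hull (_ , _ , Σw≈1 , _) = 0≉1 Σw≈1

  hull-cong : ∀ {k} {S S′ : Fin k → Point} {Z} → (∀ t → S t ≡.≡ S′ t) → InHull S Z → InHull S′ Z
  hull-cong {S = S} {S′} eq (w , w≥0 , Σw≈1 , Σx≈ , Σy≈) =
    w , w≥0 , Σw≈1 ,
    trans (sumF-cong (λ j → reflexive (≡.cong (λ P → w j * px P) (≡.sym (eq j))))) Σx≈ ,
    trans (sumF-cong (λ j → reflexive (≡.cong (λ P → w j * py P) (≡.sym (eq j))))) Σy≈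

  -- Cramer's rule: det Y Z P, det Z X P and det X Y P are det X Y Z times the
  -- barycentric coordinates of P with respect to X, Y, Z
  cramer-sum : ∀ X Y Z P → det Y Z P + det Z X P + det X Y P ≈ det X Y Z
  cramer-sum (a , b) (c , d) (e , f) (g , h) =
    solve 8 (λ a b c d e f g h →
        (((e :- c) :* (h :- d)) :- ((f :- d) :* (g :- c)))
        :+ (((a :- e) :* (h :- f)) :- ((b :- f) :* (g :- e)))
        :+ (((c :- a) :* (h :- b)) :- ((d :- b) :* (g :- a)))
        := ((c :- a) :* (f :- b)) :- ((d :- b) :* (e :- a))) refl a b c d e f g h

  cramer-x : ∀ X Y Z P → det Y Z P * px X + det Z X P * px Y + det X Y P * px Z ≈ det X Y Z * px P
  cramer-x (a , b) (c , d) (e , f) (g , h) =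
    solve 8 (λ a b c d e f g h →
        (((e :- c) :* (h :- d)) :- ((f :- d) :* (g :- c))) :* a
        :+ (((a :- e) :* (h :- f)) :- ((b :- f) :* (g :- e))) :* c
        :+ (((c :- a) :* (h :- b)) :- ((d :- b) :* (g :- a))) :* e
        := (((c :- a) :* (f :- b)) :- ((d :- b) :* (e :- a))) :* g) refl a b c d e f g h

  cramer-y : ∀ X Y Z P → det Y Z P * py X + det Z X P * py Y + det X Y P * py Z ≈ det X Y Z * py P
  cramer-y (a , b) (c , d) (e , f) (g , h) =
    solve 8 (λ a b c d e f g h →
        (((e :- c) :* (h :- d)) :- ((f :- d) :* (g :- c))) :* b
        :+ (((a :- e) :* (h :- f)) :- ((b :- f) :* (g :- e))) :* d
        :+ (((c :- a) :* (h :- b)) :- ((d :- b) :* (g :- a))) :* f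
        := (((c :- a) :* (f :- b)) :- ((d :- b) :* (e :- a))) :* h) refl a b c d e f g h

  divide-weights : ∀ {D y e₀ e₁ e₂ a b c q} → D * y ≈ 1# →
    e₀ * a + e₁ * b + e₂ * c ≈ D * q →
    e₀ * y * a + (e₁ * y * b + (e₂ * y * c + 0#)) ≈ q
  divide-weights {D} {y} {e₀} {e₁} {e₂} {a} {b} {c} {q} Dy≈1 eq = begin
    e₀ * y * a + (e₁ * y * b + (e₂ * y * c + 0#))
        ≈⟨ solve 7 (λ e₀ e₁ e₂ y a b c → e₀ :* y :* a :+ (e₁ :* y :* b :+ (e₂ :* y :* c :+ con (+ 0)))
                      := y :* (e₀ :* a :+ e₁ :* b :+ e₂ :* c)) refl e₀ e₁ e₂ y a b c ⟩
    y * (e₀ * a + e₁ * b + e₂ * c) ≈⟨ *-congˡ eq ⟩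
    y * (D * q)                    ≈⟨ solve 3 (λ y D q → y :* (D :* q) := (D :* y) :* q) refl y D q ⟩
    (D * y) * q                    ≈⟨ *-congʳ Dy≈1 ⟩
    1# * q                         ≈⟨ *-identityˡ q ⟩
    q                              ∎

  triangle-from-orientations : ∀ X Y Z P → det X Y Z < 0# →
    RightOf X Y P → RightOf Y Z P → RightOf Z X P → InTriangle X Y Z P
  triangle-from-orientations X Y Z P D<0 XY YZ ZX with inverse (det X Y Z) (<0⇒≉0 D<0)
  ... | y , Dy≈1 = w , w≥0 , Σw≈1 , Σx , Σy
    where
    y<0 : y < 0#
    y<0 = inverse-<0 D<0 Dy≈1
    w : Fin 3 → Carrier
    w Fin.zero                    = det Y Z P * y
    w (Fin.suc Fin.zero)          = det Z X P * y
    w (Fin.suc (Fin.suc Fin.zero)) = det X Y P * y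
    w≥0 : ∀ j → 0# ≤ w j
    w≥0 Fin.zero                    = ≤0×<0 YZ y<0
    w≥0 (Fin.suc Fin.zero)          = ≤0×<0 ZX y<0
    w≥0 (Fin.suc (Fin.suc Fin.zero)) = ≤0×<0 XY y<0
    Σw≈1 : sumF w ≈ 1#
    Σw≈1 = trans (sumF-cong (λ j → sym (*-identityʳ (w j))))
             (divide-weights Dy≈1 (trans (+-cong (+-cong (*-identityʳ _) (*-identityʳ _)) (*-identityʳ _))
                                   (trans (cramer-sum X Y Z P) (sym (*-identityʳ _)))))
    Σx : sumF (λ j → w j * px (tri X Y Z j)) ≈ px P
    Σx = divide-weights Dy≈1 (cramer-x X Y Z P)
    Σy : sumF (λ j → w j * py (tri X Y Z j)) ≈ py P
    Σy = divide-weights Dy≈1 (cramer-y X Y Z P)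

  -- a triangle on three vertices of a family lies in the hull of the family
  -- (the weights are spread over the family by indicators)
  triangle⇒hull : ∀ {k} (S : Fin k → Point) (a b c : Fin k) {Z} →
    InTriangle (S a) (S b) (S c) Z → InHull S Z
  triangle⇒hull {k} S a b c (u , u≥0 , Σu≈1 , Σx , Σy) =
    W , W≥0 , ΣW≈1 , trans (spread (λ t → px (S t))) Σx , trans (spread (λ t → py (S t))) Σy
    where
    u₀ = u Fin.zero
    u₁ = u (Fin.suc Fin.zero)
    u₂ = u (Fin.suc (Fin.suc Fin.zero))
    W : Fin k → Carrier
    W t = u₀ * δ a t + (u₁ * δ b t + u₂ * δ c t)
    W≥0 : ∀ t → 0# ≤ W t
    W≥0 t = 0≤+0≤ (0≤×0≤ (u≥0 _) (δ≥0 a t)) (0≤+0≤ (0≤×0≤ (u≥0 _) (δ≥0 b t)) (0≤×0≤ (u≥0 _) (δ≥0 c t)))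
    term : ∀ (x : Carrier) (d : Fin k → Carrier) (h : Fin k → Carrier) → sumF (λ t → x * (d t * h t)) ≈ x * sumF (λ t → d t * h t)
    term x d h = sumF-* x (λ t → d t * h t)
    spread : ∀ (h : Fin k → Carrier) → sumF (λ t → W t * h t) ≈ u₀ * h a + (u₁ * h b + (u₂ * h c + 0#))
    spread h = begin
      sumF (λ t → W t * h t)
        ≈⟨ sumF-cong (λ t → solve 7 (λ u₀ u₁ u₂ da db dc x →
              (u₀ :* da :+ (u₁ :* db :+ u₂ :* dc)) :* x := u₀ :* (da :* x) :+ (u₁ :* (db :* x) :+ u₂ :* (dc :* x))) refl
              u₀ u₁ u₂ (δ a t) (δ b t) (δ c t) (h t)) ⟩
      sumF (λ t → u₀ * (δ a t * h t) + (u₁ * (δ b t * h t) + u₂ * (δ c t * h t)))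
        ≈⟨ trans (sumF-+ (λ t → u₀ * (δ a t * h t)) _)
                 (+-congˡ (sumF-+ (λ t → u₁ * (δ b t * h t)) (λ t → u₂ * (δ c t * h t)))) ⟩
      sumF (λ t → u₀ * (δ a t * h t)) + (sumF (λ t → u₁ * (δ b t * h t)) + sumF (λ t → u₂ * (δ c t * h t)))
        ≈⟨ +-cong (term u₀ (δ a) h) (+-cong (term u₁ (δ b) h) (term u₂ (δ c) h)) ⟩
      u₀ * sumF (λ t → δ a t * h t) + (u₁ * sumF (λ t → δ b t * h t) + u₂ * sumF (λ t → δ c t * h t))
        ≈⟨ +-cong (*-congˡ (sumF-δ a h)) (+-cong (*-congˡ (sumF-δ b h)) (*-congˡ (sumF-δ c h))) ⟩
      u₀ * h a + (u₁ * h b + u₂ * h c)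
        ≈⟨ +-congˡ (+-congˡ (sym (+-identityʳ _))) ⟩
      u₀ * h a + (u₁ * h b + (u₂ * h c + 0#)) ∎
    ΣW≈1 : sumF W ≈ 1#
    ΣW≈1 = trans (sumF-cong (λ t → sym (*-identityʳ (W t))))
      (trans (spread (λ _ → 1#)) (trans (+-cong (*-identityʳ _) (+-cong (*-identityʳ _) (+-congʳ (*-identityʳ _)))) Σu≈1))

  triangle-rotate : ∀ {X Y Z P} → InTriangle X Y Z P → InTriangle Y Z X P
  triangle-rotate (w , w≥0 , Σw , Σx , Σy) = (λ j → w (next₃ j)) , (λ j → w≥0 (next₃ j)) , rotate Σw , rotate Σx , rotate Σy
    where
    next₃ : Fin 3 → Fin 3
    next₃ Fin.zero                     = Fin.suc Fin.zero
    next₃ (Fin.suc Fin.zero)           = Fin.suc (Fin.suc Fin.zero)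
    next₃ (Fin.suc (Fin.suc Fin.zero)) = Fin.zero
    rotate : ∀ {a b c q} → a + (b + (c + 0#)) ≈ q → b + (c + (a + 0#)) ≈ q
    rotate {a} {b} {c} eq = trans (solve 3 (λ a b c → b :+ (c :+ (a :+ con (+ 0)))
                                              := a :+ (b :+ (c :+ con (+ 0)))) refl a b c) eq

  right-or-left : ∀ P Q Z → RightOf P Q Z ⊎ (0# < det P Q Z)
  right-or-left P Q Z with compare (det P Q Z) 0#
  ... | tri< l _ _ = inj₁ (inj₁ l)
  ... | tri≈ _ e _ = inj₁ (inj₂ e)
  ... | tri> _ _ g = inj₂ g

  module ConvexQuadrilateral {a p y z : Point}
    (apy : det a p y < 0#) (apz : det a p z < 0#) (ayz : det a y z < 0#) (pyz : det p y z < 0#) where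

    split-pyz : ∀ {P} → InTriangle p y z P → InTriangle a p y P ⊎ InTriangle a y z P
    split-pyz {P} h with right-or-left a y P
    ... | inj₁ ayP = inj₂ (triangle-from-orientations a y z P ayz ayP
            (triangle-right-of y z h (inj₁ (rotate-< pyz)) (PQP-right y z) (PQQ-right y z))
            (triangle-right-of z a h (inj₁ (rotate²-< apz)) (inj₁ (rotate²-< ayz)) (PQP-right z a)))
    ... | inj₂ P-left-of-ay = inj₁ (triangle-from-orientations a p y P apy
            (triangle-right-of a p h (PQQ-right a p) (inj₁ apy) (inj₁ apz))
            (triangle-right-of p y h (PQP-right p y) (PQQ-right p y) (inj₁ pyz))
            (left⇒right-of-reverse P-left-of-ay))

    split-ayz : ∀ {P} → InTriangle a y z P → InTriangle a p z P ⊎ InTriangle p y z P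
    split-ayz {P} h with right-or-left z p P
    ... | inj₁ zpP = inj₂ (triangle-from-orientations p y z P pyz
            (triangle-right-of p y h (inj₁ (rotate-< apy)) (PQQ-right p y) (inj₁ pyz))
            (triangle-right-of y z h (inj₁ (rotate-< ayz)) (PQP-right y z) (PQQ-right y z))
            zpP)
    ... | inj₂ P-left-of-zp = inj₁ (triangle-from-orientations a p z P apz
            (triangle-right-of a p h (PQP-right a p) (inj₁ apy) (inj₁ apz))
            (left⇒right-of-reverse P-left-of-zp)
            (triangle-right-of z a h (PQQ-right z a) (inj₁ (rotate²-< ayz)) (PQP-right z a)))

  triangle-cong : ∀ {X X′ Y Y′ Z Z′ P} → X ≡.≡ X′ → Y ≡.≡ Y′ → Z ≡.≡ Z′ →
    InTriangle X Y Z P → InTriangle X′ Y′ Z′ P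
  triangle-cong ≡.refl ≡.refl ≡.refl h = h

  ClockwiseConvex : ∀ {k} → (Fin k → Point) → Set ℓ
  ClockwiseConvex S = ∀ a b c → a Fin.< b → b Fin.< c → det (S a) (S b) (S c) < 0#

  record InVertexTriangle {k} (S : Fin k → Point) (Z : Point) : Set (c ⊔ ℓ) where
    constructor vertexTriangle
    field
      u v w  : Fin k
      u<v    : u Fin.< v
      v<w    : v Fin.< w
      inside : InTriangle (S u) (S v) (S w) Z

  inject₁-< : ∀ {n} {a b : Fin n} → a Fin.< b → Fin.inject₁ a Fin.< Fin.inject₁ b
  inject₁-< {a = a} {b} a<b = ≡.subst₂ ℕ._<_ (≡.sym (Finₚ.toℕ-inject₁ a)) (≡.sym (Finₚ.toℕ-inject₁ b)) a<b

  -- If it is right of the diagonal from S 0 to the second-to-last vertex it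
  -- lies in the last triangle; otherwise drop the last vertex and recurse.
  fan-triangle : ∀ n (S : Fin (3 ℕ.+ n) → Point) → ClockwiseConvex S → ∀ {Z} →
    (∀ (t : Fin (2 ℕ.+ n)) → RightOf (S (Fin.inject₁ t)) (S (Fin.suc t)) Z) →
    RightOf (S (Fin.fromℕ (2 ℕ.+ n))) (S Fin.zero) Z → InVertexTriangle S Z
  fan-triangle zero S convex {Z} edges closing =
    vertexTriangle Fin.zero (Fin.suc Fin.zero) (Fin.suc (Fin.suc Fin.zero)) i0<i1 i1<i2
      (triangle-from-orientations _ _ _ Z (convex _ _ _ i0<i1 i1<i2) (edges Fin.zero) (edges (Fin.suc Fin.zero)) closing)
    where
    i0<i1 = ℕ.s≤s ℕ.z≤n
    i1<i2 = ℕ.s≤s (ℕ.s≤s ℕ.z≤n)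
  fan-triangle (suc m) S convex {Z} edges closing = step (right-or-left (S Fin.zero) (S last′) Z)
    where
    last′ : Fin (4 ℕ.+ m)
    last′ = Fin.inject₁ (Fin.fromℕ (2 ℕ.+ m))
    toℕ-last′ : Fin.toℕ last′ ≡.≡ 2 ℕ.+ m
    toℕ-last′ = ≡.trans (Finₚ.toℕ-inject₁ (Fin.fromℕ (2 ℕ.+ m))) (Finₚ.toℕ-fromℕ (2 ℕ.+ m))
    0<last′ : Fin.zero {3 ℕ.+ m} Fin.< last′
    0<last′ = ≡.subst (0 ℕ.<_) (≡.sym toℕ-last′) (ℕ.s≤s ℕ.z≤n)
    last′<last : last′ Fin.< Fin.fromℕ (3 ℕ.+ m)
    last′<last = ≡.subst₂ ℕ._<_ (≡.sym toℕ-last′) (≡.sym (Finₚ.toℕ-fromℕ (3 ℕ.+ m))) (ℕₚ.n<1+n (2 ℕ.+ m))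
    S′ : Fin (3 ℕ.+ m) → Point
    S′ t = S (Fin.inject₁ t)
    lift : InVertexTriangle S′ Z → InVertexTriangle S Z
    lift (vertexTriangle u v w u<v v<w inside) =
      vertexTriangle (Fin.inject₁ u) (Fin.inject₁ v) (Fin.inject₁ w) (inject₁-< u<v) (inject₁-< v<w) inside
    step : RightOf (S Fin.zero) (S last′) Z ⊎ (0# < det (S Fin.zero) (S last′) Z) → InVertexTriangle S Z
    step (inj₁ right) = vertexTriangle Fin.zero last′ (Fin.fromℕ (3 ℕ.+ m)) 0<last′ last′<last
      (triangle-from-orientations _ _ _ Z (convex _ _ _ 0<last′ last′<last)
         right (edges (Fin.fromℕ (2 ℕ.+ m))) closing)
    step (inj₂ left) = lift (fan-triangle m S′ (λ a b c a<b b<c → convex _ _ _ (inject₁-< a<b) (inject₁-< b<c))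
                              (λ t → edges (Fin.inject₁ t)) (left⇒right-of-reverse left))

  -- Every vertex of a clockwise convex polygon is weakly right of every edge,
  -- so every point of its hull is; by the fan triangulation it lies in a
  -- triangle of vertices.
  hull⇒vertex-triangle : ∀ n (S : Fin (3 ℕ.+ n) → Point) → ClockwiseConvex S → ∀ {Z} →
    InHull S Z → InVertexTriangle S Z
  hull⇒vertex-triangle n S convex h =
    fan-triangle n S convex (λ t → hull-right-of _ _ h (edge t)) (hull-right-of _ _ h closing)
    where
    same-vertex : ∀ {a b} → Fin.toℕ a ≡.≡ Fin.toℕ b → S a ≡.≡ S b
    same-vertex eq = ≡.cong S (Finₚ.toℕ-injective eq)
    edge : ∀ (t : Fin (2 ℕ.+ n)) r → RightOf (S (Fin.inject₁ t)) (S (Fin.suc t)) (S r)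
    edge t r with ℕₚ.<-cmp (Fin.toℕ r) (Fin.toℕ t)
    ... | tri< r<t _ _ = inj₁ (rotate-< (convex r (Fin.inject₁ t) (Fin.suc t)
            (≡.subst (Fin.toℕ r ℕ.<_) (≡.sym (Finₚ.toℕ-inject₁ t)) r<t)
            (≡.subst (ℕ._< suc (Fin.toℕ t)) (≡.sym (Finₚ.toℕ-inject₁ t)) (ℕₚ.n<1+n _))))
    ... | tri≈ _ r≡t _ = ≡.subst (RightOf (S (Fin.inject₁ t)) (S (Fin.suc t)))
            (same-vertex (≡.trans (Finₚ.toℕ-inject₁ t) (≡.sym r≡t))) (PQP-right _ _)
    ... | tri> _ _ t<r with ℕₚ.m≤n⇒m<n∨m≡n t<r
    ...   | inj₁ t+1<r = inj₁ (convex (Fin.inject₁ t) (Fin.suc t) r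
            (≡.subst (ℕ._< suc (Fin.toℕ t)) (≡.sym (Finₚ.toℕ-inject₁ t)) (ℕₚ.n<1+n _)) t+1<r)
    ...   | inj₂ t+1≡r = ≡.subst (RightOf (S (Fin.inject₁ t)) (S (Fin.suc t))) (same-vertex t+1≡r) (PQQ-right _ _)
    last : Fin (3 ℕ.+ n)
    last = Fin.fromℕ (2 ℕ.+ n)
    closing : ∀ r → RightOf (S last) (S Fin.zero) (S r)
    closing Fin.zero = PQQ-right _ _
    closing (Fin.suc r) with ℕₚ.<-cmp (suc (Fin.toℕ r)) (Fin.toℕ last)
    ... | tri< r<last _ _ = inj₁ (rotate²-< (convex Fin.zero (Fin.suc r) last (ℕ.s≤s ℕ.z≤n) r<last))
    ... | tri≈ _ r≡last _ = ≡.subst (RightOf (S last) (S Fin.zero)) (same-vertex (≡.sym r≡last)) (PQP-right _ _)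
    ... | tri> _ _ last<r = ⊥-elim (ℕₚ.<⇒≱ last<r
            (≡.subst (Fin.toℕ (Fin.suc r) ℕ.≤_) (≡.sym (Finₚ.toℕ-fromℕ (2 ℕ.+ n))) (ℕₚ.≤-pred (Finₚ.toℕ<n (Fin.suc r)))))

-- CycOrd x y z says that going upwards from x (and
-- wrapping around) one meets y strictly before z.  It is measured by the
-- cyclic distance dist x y, the representative of toℕ y - toℕ x modulo n:
-- CycOrd x y z holds iff 0 < dist x y < dist x z.
module CyclicOrder where
  open import Data.Nat as ℕ using (ℕ; zero; suc; _+_; _∸_; z≤n; s≤s; NonZero)
  import Data.Nat.Properties as ℕₚ
  open import Data.Nat.DivMod using (_%_; m<n⇒m%n≡m; m%n%n≡m%n; %-distribˡ-+; [m+n]%n≡m%n)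
  open import Data.Fin as Fin using (Fin; toℕ)
  import Data.Fin.Properties as Finₚ
  open import Data.Product using (_×_; _,_)
  open import Data.Sum using (_⊎_; inj₁; inj₂)
  open import Data.Empty using (⊥-elim)
  open import Relation.Nullary using (yes; no)
  open import Relation.Binary.PropositionalEquality
  open ≡-Reasoning

  CycOrd : ∀ {n} → Fin n → Fin n → Fin n → Set
  CycOrd x y z = (x Fin.< y × y Fin.< z) ⊎ (y Fin.< z × z Fin.< x) ⊎ (z Fin.< x × x Fin.< y)

  cyc-rotate : ∀ {n} {x y z : Fin n} → CycOrd x y z → CycOrd y z x
  cyc-rotate (inj₁ xyz)        = inj₂ (inj₂ xyz)
  cyc-rotate (inj₂ (inj₁ yzx)) = inj₁ yzx
  cyc-rotate (inj₂ (inj₂ zxy)) = inj₂ (inj₁ zxy)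

  cyc-distinct₁₂ : ∀ {n} {x y z : Fin n} → CycOrd x y z → x ≢ y
  cyc-distinct₁₂ (inj₁ (x<y , _))        = Finₚ.<⇒≢ x<y
  cyc-distinct₁₂ (inj₂ (inj₁ (y<z , z<x))) x≡y = Finₚ.<⇒≢ (ℕₚ.<-trans y<z z<x) (sym x≡y)
  cyc-distinct₁₂ (inj₂ (inj₂ (_ , x<y))) = Finₚ.<⇒≢ x<y

  cyc-distinct₃₁ : ∀ {n} {x y z : Fin n} → CycOrd x y z → z ≢ x
  cyc-distinct₃₁ c = cyc-distinct₁₂ (cyc-rotate (cyc-rotate c))

  cyc-map : ∀ {n m} (f : Fin n → Fin m) → (∀ {a b} → a Fin.< b → f a Fin.< f b) →
    ∀ {x y z} → CycOrd x y z → CycOrd (f x) (f y) (f z)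
  cyc-map f mono (inj₁ (a , b))        = inj₁ (mono a , mono b)
  cyc-map f mono (inj₂ (inj₁ (a , b))) = inj₂ (inj₁ (mono a , mono b))
  cyc-map f mono (inj₂ (inj₂ (a , b))) = inj₂ (inj₂ (mono a , mono b))

  dist : ∀ {n} → Fin n → Fin n → ℕ
  dist {n} x y with toℕ x ℕ.≤? toℕ y
  ... | yes _ = toℕ y ∸ toℕ x
  ... | no _  = (n + toℕ y) ∸ toℕ x

  data DistView {n} (x y : Fin n) (d : ℕ) : Set where
    upwards : toℕ x ℕ.≤ toℕ y → d + toℕ x ≡ toℕ y → DistView x y d
    wrapped : toℕ y ℕ.< toℕ x → d + toℕ x ≡ n + toℕ y → DistView x y d

  distView : ∀ {n} (x y : Fin n) → DistView x y (dist x y)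
  distView {n} x y with toℕ x ℕ.≤? toℕ y
  ... | yes x≤y = upwards x≤y (ℕₚ.m∸n+n≡m x≤y)
  ... | no x≰y  = wrapped (ℕₚ.≰⇒> x≰y)
                   (ℕₚ.m∸n+n≡m (ℕₚ.≤-trans (ℕₚ.<⇒≤ (Finₚ.toℕ<n x)) (ℕₚ.m≤m+n n (toℕ y))))

  distView-unique : ∀ {n} {x y : Fin n} {d d′} → DistView x y d → DistView x y d′ → d ≡ d′
  distView-unique (upwards _ e)   (upwards _ e′)  = ℕₚ.+-cancelʳ-≡ _ _ _ (trans e (sym e′))
  distView-unique (upwards x≤y _) (wrapped y<x _) = ⊥-elim (ℕₚ.<⇒≱ y<x x≤y)
  distView-unique (wrapped y<x _) (upwards x≤y _) = ⊥-elim (ℕₚ.<⇒≱ y<x x≤y)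
  distView-unique (wrapped _ e)   (wrapped _ e′)  = ℕₚ.+-cancelʳ-≡ _ _ _ (trans e (sym e′))

  mod-view : ∀ {n} .{{_ : NonZero n}} m → m ℕ.< n + n → (m ℕ.< n × m % n ≡ m) ⊎ (m % n + n ≡ m)
  mod-view {n} m m<2n with m ℕ.<? n
  ... | yes m<n = inj₁ (m<n , m<n⇒m%n≡m m<n)
  ... | no m≮n  = inj₂ (begin
      m % n + n             ≡⟨ cong (λ v → v % n + n) (sym r+n≡m) ⟩
      (r + n) % n + n       ≡⟨ cong (_+ n) ([m+n]%n≡m%n r n) ⟩
      r % n + n             ≡⟨ cong (_+ n) (m<n⇒m%n≡m r<n) ⟩
      r + n                 ≡⟨ r+n≡m ⟩
      m                     ∎)
    where
    r = m ∸ n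
    r+n≡m : r + n ≡ m
    r+n≡m = ℕₚ.m∸n+n≡m (ℕₚ.≮⇒≥ m≮n)
    r<n : r ℕ.< n
    r<n = ℕₚ.+-cancelʳ-< n r n (subst (ℕ._< n + n) (sym r+n≡m) m<2n)

  mod-absorbˡ : ∀ m d n .{{_ : NonZero n}} → (m % n + d) % n ≡ (m + d) % n
  mod-absorbˡ m d n = begin
    (m % n + d) % n           ≡⟨ %-distribˡ-+ (m % n) d n ⟩
    (m % n % n + d % n) % n   ≡⟨ cong (λ v → (v + d % n) % n) (m%n%n≡m%n m n) ⟩
    (m % n + d % n) % n       ≡⟨ %-distribˡ-+ m d n ⟨
    (m + d) % n               ∎

  module _ {k : ℕ} where
    private
      n : ℕ
      n = suc k
      toℕ-mod : (x : Fin n) → toℕ x % n ≡ toℕ x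
      toℕ-mod x = m<n⇒m%n≡m (Finₚ.toℕ<n x)

    dist-spec : (x y : Fin n) → toℕ y ≡ (toℕ x + dist x y) % n
    dist-spec x y with distView x y
    ... | upwards _ e = sym (trans (cong (_% n) (trans (ℕₚ.+-comm (toℕ x) _) e)) (toℕ-mod y))
    ... | wrapped _ e = sym (begin
      (toℕ x + dist x y) % n ≡⟨ cong (_% n) (trans (ℕₚ.+-comm (toℕ x) _) e) ⟩
      (n + toℕ y) % n        ≡⟨ cong (_% n) (ℕₚ.+-comm n (toℕ y)) ⟩
      (toℕ y + n) % n        ≡⟨ [m+n]%n≡m%n (toℕ y) n ⟩
      toℕ y % n              ≡⟨ toℕ-mod y ⟩
      toℕ y                  ∎)

    dist-of-mod : ∀ {x y : Fin n} {d} → d ℕ.< n → toℕ y ≡ (toℕ x + d) % n → dist x y ≡ d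
    dist-of-mod {x} {y} {d} d<n eq = distView-unique (distView x y) view
      where
      view : DistView x y d
      view with mod-view (toℕ x + d) (ℕₚ.+-mono-< (Finₚ.toℕ<n x) d<n)
      ... | inj₁ (_ , r≡) = upwards (subst (toℕ x ℕ.≤_) (sym y≡) (ℕₚ.m≤m+n _ d))
                                    (trans (ℕₚ.+-comm d (toℕ x)) (sym y≡))
        where y≡ = trans eq r≡
      ... | inj₂ r+n≡ = wrapped (ℕₚ.+-cancelʳ-< n _ _ (subst (ℕ._< toℕ x + n) (sym y+n≡) (ℕₚ.+-monoʳ-< (toℕ x) d<n)))
                                (trans (ℕₚ.+-comm d (toℕ x)) (trans (sym y+n≡) (ℕₚ.+-comm (toℕ y) n)))
        where y+n≡ = trans (cong (_+ n) eq) r+n≡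

    dist-self : (x : Fin n) → dist x x ≡ 0
    dist-self x = dist-of-mod {x} {x} (s≤s z≤n) (sym (trans (cong (_% n) (ℕₚ.+-identityʳ (toℕ x))) (toℕ-mod x)))

    dist-injective : ∀ {x y z : Fin n} → dist x y ≡ dist x z → y ≡ z
    dist-injective {x} {y} {z} e = Finₚ.toℕ-injective
      (trans (dist-spec x y) (trans (cong (λ d → (toℕ x + d) % n) e) (sym (dist-spec x z))))

    dist≡0⇒≡ : ∀ {x y : Fin n} → dist x y ≡ 0 → x ≡ y
    dist≡0⇒≡ {x} {y} e = sym (dist-injective {x} {y} {x} (trans e (sym (dist-self x))))

    dist-of-mod-suc : ∀ {x y : Fin n} {d} → d ℕ.< n → y ≢ x → toℕ y ≡ (toℕ x + suc d) % n → dist x y ≡ suc d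
    dist-of-mod-suc {x} {y} {d} d<n y≢x eq = dist-of-mod {x} {y} (ℕₚ.≤∧≢⇒< d<n suc-d≢n) eq
      where
      suc-d≢n : suc d ≢ n
      suc-d≢n refl = y≢x (Finₚ.toℕ-injective (begin
        toℕ y             ≡⟨ eq ⟩
        (toℕ x + n) % n   ≡⟨ [m+n]%n≡m%n (toℕ x) n ⟩
        toℕ x % n         ≡⟨ toℕ-mod x ⟩
        toℕ x             ∎))

    dist<n : (x y : Fin n) → dist x y ℕ.< n
    dist<n x y with distView x y
    ... | upwards _ e = ℕₚ.≤-<-trans (ℕₚ.m≤m+n _ _) (subst (ℕ._< n) (sym e) (Finₚ.toℕ<n y))
    ... | wrapped y<x e = ℕₚ.+-cancelʳ-< (toℕ x) _ _ (subst (ℕ._< n + toℕ x) (sym e) (ℕₚ.+-monoʳ-< n y<x))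

    toℕ-next : (y : Fin n) → toℕ (next y) ≡ suc (toℕ y) % n
    toℕ-next y = Finₚ.toℕ-fromℕ< _

    next-step : ∀ {x y : Fin n} {d} → toℕ y ≡ (toℕ x + d) % n → toℕ (next y) ≡ (toℕ x + suc d) % n
    next-step {x} {y} {d} eq = begin
      toℕ (next y)              ≡⟨ toℕ-next y ⟩
      suc (toℕ y) % n           ≡⟨ cong (λ v → suc v % n) eq ⟩
      (1 + (toℕ x + d) % n) % n ≡⟨ cong (_% n) (ℕₚ.+-comm 1 _) ⟩
      ((toℕ x + d) % n + 1) % n ≡⟨ mod-absorbˡ (toℕ x + d) 1 n ⟩
      (toℕ x + d + 1) % n       ≡⟨ cong (_% n) (trans (ℕₚ.+-assoc (toℕ x) d 1) (cong (toℕ x +_) (ℕₚ.+-comm d 1))) ⟩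
      (toℕ x + suc d) % n       ∎

    dist-next-source : ∀ {x u : Fin n} → u ≢ x → dist x u ≡ suc (dist (next x) u)
    dist-next-source {x} {u} ne = dist-of-mod-suc {x} {u} (dist<n (next x) u) ne (begin
      toℕ u                              ≡⟨ dist-spec (next x) u ⟩
      (toℕ (next x) + d) % n             ≡⟨ cong (λ v → (v + d) % n) (toℕ-next x) ⟩
      (suc (toℕ x) % n + d) % n          ≡⟨ mod-absorbˡ (suc (toℕ x)) d n ⟩
      (suc (toℕ x) + d) % n              ≡⟨ cong (_% n) (sym (ℕₚ.+-suc (toℕ x) d)) ⟩
      (toℕ x + suc d) % n                ∎)
      where d = dist (next x) u

    dist⇒cyc : ∀ {x y z : Fin n} → 0 ℕ.< dist x y → dist x y ℕ.< dist x z → CycOrd x y z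
    dist⇒cyc {x} {y} {z} 0<d d<d′ with distView x y | distView x z
    ... | upwards _ e₁ | upwards _ e₂ =
      inj₁ (subst (toℕ x ℕ.<_) e₁ (ℕₚ.+-monoˡ-< (toℕ x) 0<d) , subst₂ ℕ._<_ e₁ e₂ (ℕₚ.+-monoˡ-< (toℕ x) d<d′))
    ... | upwards _ e₁ | wrapped z<x _ = inj₂ (inj₂ (z<x , subst (toℕ x ℕ.<_) e₁ (ℕₚ.+-monoˡ-< (toℕ x) 0<d)))
    ... | wrapped _ e₁ | upwards _ e₂ = ⊥-elim (ℕₚ.<-asym (Finₚ.toℕ<n z)
            (ℕₚ.≤-<-trans (ℕₚ.m≤m+n n (toℕ y)) (subst₂ ℕ._<_ e₁ e₂ (ℕₚ.+-monoˡ-< (toℕ x) d<d′))))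
    ... | wrapped _ e₁ | wrapped z<x e₂ =
      inj₂ (inj₁ (ℕₚ.+-cancelˡ-< n _ _ (subst₂ ℕ._<_ e₁ e₂ (ℕₚ.+-monoˡ-< (toℕ x) d<d′)) , z<x))

    cyc⇒dist : ∀ {x y z : Fin n} → CycOrd x y z → dist x y ℕ.< dist x z
    cyc⇒dist {x} {y} {z} c = ℕₚ.+-cancelʳ-< (toℕ x) _ _ (views c (distView x y) (distView x z))
      where
      views : CycOrd x y z → DistView x y (dist x y) → DistView x z (dist x z) →
              dist x y + toℕ x ℕ.< dist x z + toℕ x
      views (inj₁ (_ , y<z))        (upwards _ e₁) (upwards _ e₂) = subst₂ ℕ._<_ (sym e₁) (sym e₂) y<z
      views (inj₁ (x<y , y<z))      _ (wrapped z<x _) = ⊥-elim (ℕₚ.<-asym (ℕₚ.<-trans x<y y<z) z<x)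
      views (inj₁ (x<y , _))        (wrapped y<x _) _ = ⊥-elim (ℕₚ.<-asym x<y y<x)
      views (inj₂ (inj₁ (y<z , z<x))) (upwards x≤y _) _ = ⊥-elim (ℕₚ.<⇒≱ (ℕₚ.<-trans y<z z<x) x≤y)
      views (inj₂ (inj₁ (_ , z<x)))  (wrapped _ _) (upwards x≤z _) = ⊥-elim (ℕₚ.<⇒≱ z<x x≤z)
      views (inj₂ (inj₁ (y<z , _)))  (wrapped _ e₁) (wrapped _ e₂) =
        subst₂ ℕ._<_ (sym e₁) (sym e₂) (ℕₚ.+-monoʳ-< n y<z)
      views (inj₂ (inj₂ (z<x , _)))  _ (upwards x≤z _) = ⊥-elim (ℕₚ.<⇒≱ z<x x≤z)
      views (inj₂ (inj₂ (_ , _)))    (upwards _ e₁) (wrapped _ e₂) =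
        subst₂ ℕ._<_ (sym e₁) (sym e₂) (ℕₚ.<-≤-trans (Finₚ.toℕ<n y) (ℕₚ.m≤m+n n (toℕ z)))
      views (inj₂ (inj₂ (_ , x<y)))  (wrapped y<x _) _ = ⊥-elim (ℕₚ.<-asym x<y y<x)

    toℕ-as-mod : (x : Fin n) → toℕ x ≡ (toℕ x + 0) % n
    toℕ-as-mod x = sym (trans (cong (_% n) (ℕₚ.+-identityʳ (toℕ x))) (toℕ-mod x))

    wrap-around : (x : Fin n) → (toℕ x + n) % n ≡ toℕ x
    wrap-around x = trans ([m+n]%n≡m%n (toℕ x) n) (toℕ-mod x)

    toℕ-prev : (x : Fin n) → toℕ (prev x) ≡ (toℕ x + k) % n
    toℕ-prev x = Finₚ.toℕ-fromℕ< _

    next-prev : (x : Fin n) → next (prev x) ≡ x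
    next-prev x = Finₚ.toℕ-injective
      (trans (next-step {x} {prev x} (toℕ-prev x)) (wrap-around x))

    prev-next : (x : Fin n) → prev (next x) ≡ x
    prev-next x = Finₚ.toℕ-injective (begin
      toℕ (prev (next x))          ≡⟨ toℕ-prev (next x) ⟩
      (toℕ (next x) + k) % n       ≡⟨ cong (λ v → (v + k) % n) (toℕ-next x) ⟩
      (suc (toℕ x) % n + k) % n    ≡⟨ mod-absorbˡ (suc (toℕ x)) k n ⟩
      (suc (toℕ x) + k) % n        ≡⟨ cong (_% n) (sym (ℕₚ.+-suc (toℕ x) k)) ⟩
      (toℕ x + n) % n              ≡⟨ wrap-around x ⟩
      toℕ x                        ∎)

    toℕ-consec : (s : Fin n) (l : ℕ) (t : Fin l) → toℕ (consec s l t) ≡ (toℕ s + toℕ t) % n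
    toℕ-consec s l t = Finₚ.toℕ-fromℕ< _

    dist-consec : (s : Fin n) (l : ℕ) → l ℕ.≤ n → (a b : Fin l) → toℕ a ℕ.≤ toℕ b →
      dist (consec s l a) (consec s l b) ≡ toℕ b ∸ toℕ a
    dist-consec s l l≤n a b a≤b = dist-of-mod {consec s l a} {consec s l b}
      (ℕₚ.≤-<-trans (ℕₚ.m∸n≤m (toℕ b) (toℕ a)) (ℕₚ.<-≤-trans (Finₚ.toℕ<n b) l≤n)) (begin
        toℕ (consec s l b)                        ≡⟨ toℕ-consec s l b ⟩
        (toℕ s + toℕ b) % n                       ≡⟨ cong (λ v → (toℕ s + v) % n) (sym (ℕₚ.m+[n∸m]≡n a≤b)) ⟩
        (toℕ s + (toℕ a + (toℕ b ∸ toℕ a))) % n   ≡⟨ cong (_% n) (sym (ℕₚ.+-assoc (toℕ s) (toℕ a) _)) ⟩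
        (toℕ s + toℕ a + (toℕ b ∸ toℕ a)) % n     ≡⟨ mod-absorbˡ (toℕ s + toℕ a) _ n ⟨
        ((toℕ s + toℕ a) % n + (toℕ b ∸ toℕ a)) % n ≡⟨ cong (λ v → (v + (toℕ b ∸ toℕ a)) % n) (sym (toℕ-consec s l a)) ⟩
        (toℕ (consec s l a) + (toℕ b ∸ toℕ a)) % n ∎)

    cyc-consec : (s : Fin n) (l : ℕ) → l ℕ.≤ n → ∀ (a b c : Fin l) →
      a Fin.< b → b Fin.< c → CycOrd (consec s l a) (consec s l b) (consec s l c)
    cyc-consec s l l≤n a b c a<b b<c = dist⇒cyc
      (subst (0 ℕ.<_) (sym dist-ab) (ℕₚ.m<n⇒0<n∸m a<b))
      (subst₂ ℕ._<_ (sym dist-ab) (sym dist-ac) (ℕₚ.∸-monoˡ-< b<c (ℕₚ.<⇒≤ a<b)))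
      where
      dist-ab = dist-consec s l l≤n a b (ℕₚ.<⇒≤ a<b)
      dist-ac = dist-consec s l l≤n a c (ℕₚ.<⇒≤ (ℕₚ.<-trans a<b b<c))

    consec-injective : (s : Fin n) (l : ℕ) → l ℕ.≤ n → ∀ (a b : Fin l) → consec s l a ≡ consec s l b → a ≡ b
    consec-injective s l l≤n a b eq with ℕₚ.≤-total (toℕ a) (toℕ b)
    ... | inj₁ a≤b = Finₚ.toℕ-injective (ℕₚ.≤-antisym a≤b (ℕₚ.m∸n≡0⇒m≤n (begin
          toℕ b ∸ toℕ a                        ≡⟨ dist-consec s l l≤n a b a≤b ⟨
          dist (consec s l a) (consec s l b)   ≡⟨ cong (dist (consec s l a)) (sym eq) ⟩
          dist (consec s l a) (consec s l a)   ≡⟨ dist-self (consec s l a) ⟩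
          0                                    ∎)))
    ... | inj₂ b≤a = Finₚ.toℕ-injective (ℕₚ.≤-antisym (ℕₚ.m∸n≡0⇒m≤n (begin
          toℕ a ∸ toℕ b                        ≡⟨ dist-consec s l l≤n b a b≤a ⟨
          dist (consec s l b) (consec s l a)   ≡⟨ cong (dist (consec s l b)) eq ⟩
          dist (consec s l b) (consec s l b)   ≡⟨ dist-self (consec s l b) ⟩
          0                                    ∎)) b≤a)

  at-least-2 : ∀ {m} → m ≢ 0 → m ≢ 1 → 2 ℕ.≤ m
  at-least-2 {zero}          m≢0 _   = ⊥-elim (m≢0 refl)
  at-least-2 {suc zero}      _   m≢1 = ⊥-elim (m≢1 refl)
  at-least-2 {suc (suc m)}   _   _   = s≤s (s≤s z≤n)

  at-least-3 : ∀ {m} → m ≢ 0 → m ≢ 1 → m ≢ 2 → 3 ℕ.≤ m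
  at-least-3 {zero}              m≢0 _   _   = ⊥-elim (m≢0 refl)
  at-least-3 {suc zero}          _   m≢1 _   = ⊥-elim (m≢1 refl)
  at-least-3 {suc (suc zero)}    _   _   m≢2 = ⊥-elim (m≢2 refl)
  at-least-3 {suc (suc (suc m))} _   _   _   = s≤s (s≤s (s≤s z≤n))

  dist-next : ∀ {k} (x : Fin (suc (suc k))) → dist x (next x) ≡ 1
  dist-next x = dist-of-mod {x = x} {next x} (s≤s (s≤s z≤n)) (next-step {x = x} {x} (toℕ-as-mod x))

  dist-next² : ∀ {k} (x : Fin (3 ℕ.+ k)) → dist x (next (next x)) ≡ 2
  dist-next² x = dist-of-mod {x = x} {next (next x)} (s≤s (s≤s (s≤s z≤n)))
    (next-step {x = x} {next x} (next-step {x = x} {x} (toℕ-as-mod x)))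

  next≢ : ∀ {k} (x : Fin (suc (suc k))) → next x ≢ x
  next≢ x e = ℕₚ.1+n≢0 (trans (sym (dist-next x)) (trans (cong (dist x) e) (dist-self x)))

  next²≢ : ∀ {k} (x : Fin (3 ℕ.+ k)) → next (next x) ≢ x
  next²≢ x e = ℕₚ.1+n≢0 (trans (sym (dist-next² x)) (trans (cong (dist x) e) (dist-self x)))

  cyc-next : ∀ {k} (u y : Fin (suc (suc k))) → y ≢ u → y ≢ next u → CycOrd u (next u) y
  cyc-next u y y≢u y≢u⁺ = dist⇒cyc (subst (0 ℕ.<_) (sym (dist-next u)) (s≤s z≤n))
    (subst (ℕ._< dist u y) (sym (dist-next u)) (at-least-2
      (λ e → y≢u (sym (dist≡0⇒≡ {x = u} e)))
      (λ e → y≢u⁺ (dist-injective {x = u} (trans e (sym (dist-next u)))))))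

  cyc-next² : ∀ {k} (u y : Fin (3 ℕ.+ k)) → y ≢ u → y ≢ next u → y ≢ next (next u) →
    CycOrd u (next (next u)) y
  cyc-next² u y y≢u y≢u⁺ y≢u⁺⁺ = dist⇒cyc (subst (0 ℕ.<_) (sym (dist-next² u)) (s≤s z≤n))
    (subst (ℕ._< dist u y) (sym (dist-next² u)) (at-least-3
      (λ e → y≢u (sym (dist≡0⇒≡ {x = u} e)))
      (λ e → y≢u⁺ (dist-injective {x = u} (trans e (sym (dist-next u)))))
      (λ e → y≢u⁺⁺ (dist-injective {x = u} (trans e (sym (dist-next² u)))))))

  cyc-unshift : ∀ {k} {u y z : Fin (suc k)} → CycOrd (next u) y z → y ≢ u → z ≢ u → CycOrd u y z
  cyc-unshift c y≢u z≢u = dist⇒cyc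
    (subst (0 ℕ.<_) (sym (dist-next-source y≢u)) (s≤s z≤n))
    (subst₂ ℕ._<_ (sym (dist-next-source y≢u)) (sym (dist-next-source z≢u)) (s≤s (cyc⇒dist c)))

module PunchIn where
  open import Data.Nat as ℕ using (ℕ; suc; s≤s)
  import Data.Nat.Properties as ℕₚ
  open import Data.Fin as Fin using (Fin; toℕ; punchIn)
  import Data.Fin.Properties as Finₚ
  open import Relation.Binary.PropositionalEquality using (_≡_; refl; cong)

  punchIn-< : ∀ {n} (i : Fin (suc n)) {a b : Fin n} → a Fin.< b → punchIn i a Fin.< punchIn i b
  punchIn-< i {a} {b} a<b = ℕₚ.≤∧≢⇒< (Finₚ.punchIn-mono-≤ i a b (ℕₚ.<⇒≤ a<b))
    (λ e → Finₚ.<⇒≢ a<b (Finₚ.punchIn-injective i a b (Finₚ.toℕ-injective e)))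

  toℕ-punchIn-below : ∀ {n} (i : Fin (suc n)) (j : Fin n) → toℕ j ℕ.< toℕ i → toℕ (punchIn i j) ≡ toℕ j
  toℕ-punchIn-below (Fin.suc i) Fin.zero    _         = refl
  toℕ-punchIn-below (Fin.suc i) (Fin.suc j) (s≤s j<i) = cong suc (toℕ-punchIn-below i j j<i)

  toℕ-punchIn-above : ∀ {n} (i : Fin (suc n)) (j : Fin n) → toℕ i ℕ.≤ toℕ j → toℕ (punchIn i j) ≡ suc (toℕ j)
  toℕ-punchIn-above Fin.zero    j           _         = refl
  toℕ-punchIn-above (Fin.suc i) (Fin.suc j) (s≤s i≤j) = cong suc (toℕ-punchIn-above i j i≤j)

-- The map
-- collapse sends p to i and fixes every other index: A_i takes over the
-- place of A_p.  On the indices of the two smaller diagrams this becomes a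
-- rotation σ (the identity, or prev when i is the last index):
-- punchIn p ∘ σ = collapse ∘ punchIn i.
module Relabelling {k : ℕ} (i : Fin (suc (suc k))) where
  open import Data.Nat as ℕ using (ℕ; zero; suc)
  import Data.Nat.Properties as ℕₚ
  open import Data.Nat.DivMod using (_%_; m<n⇒m%n≡m; n%n≡0; [m+n]%n≡m%n)
  open import Data.Fin as Fin using (Fin; toℕ; punchIn)
  import Data.Fin.Properties as Finₚ
  open import Data.Product using (Σ; _×_; _,_)
  open import Data.Sum using (inj₁; inj₂)
  open import Data.Empty using (⊥-elim)
  open import Relation.Nullary using (yes; no)
  open import Relation.Binary.Definitions using (tri<; tri≈; tri>)
  open import Relation.Binary.PropositionalEquality
  open import Function.Bundles using (_↔_; Inverse; mk↔ₛ′)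
  open import Function.Construct.Identity using (↔-id)
  open CyclicOrder
  open PunchIn

  p : Fin (suc (suc k))
  p = next i

  collapse : Fin (suc (suc k)) → Fin (suc (suc k))
  collapse u with u Fin.≟ p
  ... | yes _ = i
  ... | no _  = u

  collapse-p : ∀ {u} → u ≡ p → collapse u ≡ i
  collapse-p {u} u≡p with u Fin.≟ p
  ... | yes _   = refl
  ... | no u≢p  = ⊥-elim (u≢p u≡p)

  collapse-other : ∀ {u} → u ≢ p → collapse u ≡ u
  collapse-other {u} u≢p with u Fin.≟ p
  ... | yes u≡p = ⊥-elim (u≢p u≡p)
  ... | no _    = refl

  -- i is not the last index: p = i + 1 and σ is the identity
  up-to-i<p : toℕ p ≡ suc (toℕ i) → ∀ {m} → m ℕ.≤ toℕ i → m ℕ.< toℕ p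
  up-to-i<p p≡i+1 {m} m≤i = subst (m ℕ.<_) (sym p≡i+1) (ℕ.s≤s m≤i)

  collapse-not-last : toℕ p ≡ suc (toℕ i) → ∀ j → punchIn p j ≡ collapse (punchIn i j)
  collapse-not-last p≡i+1 j with ℕₚ.<-cmp (toℕ j) (toℕ i)
  ... | tri< j<i _ _ = trans (Finₚ.toℕ-injective (trans (toℕ-punchIn-below p j (up-to-i<p p≡i+1 (ℕₚ.<⇒≤ j<i)))
                                                       (sym (toℕ-punchIn-below i j j<i))))
                             (sym (collapse-other (λ e → ℕₚ.<⇒≢ (up-to-i<p p≡i+1 (ℕₚ.<⇒≤ j<i))
                                    (trans (sym (toℕ-punchIn-below i j j<i)) (cong toℕ e)))))
  ... | tri≈ _ j≡i _ = trans (Finₚ.toℕ-injective (trans (toℕ-punchIn-below p j (up-to-i<p p≡i+1 (ℕₚ.≤-reflexive j≡i))) j≡i))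
                             (sym (collapse-p (Finₚ.toℕ-injective
                               (trans (toℕ-punchIn-above i j (ℕₚ.≤-reflexive (sym j≡i)))
                                      (trans (cong suc j≡i) (sym p≡i+1))))))
  ... | tri> _ _ i<j = trans (Finₚ.toℕ-injective (trans (toℕ-punchIn-above p j (subst (ℕ._≤ toℕ j) (sym p≡i+1) i<j))
                                                       (sym (toℕ-punchIn-above i j (ℕₚ.<⇒≤ i<j)))))
                             (sym (collapse-other (λ e → ℕₚ.<⇒≢ i<j (ℕₚ.suc-injective
                                    (trans (sym p≡i+1) (trans (sym (cong toℕ e)) (toℕ-punchIn-above i j (ℕₚ.<⇒≤ i<j))))))))

  -- i is the last index: p = 0 and σ = prev
  collapse-last : p ≡ Fin.zero → toℕ i ≡ suc k → ∀ j → punchIn p (prev j) ≡ collapse (punchIn i j)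
  collapse-last p≡0 i≡last Fin.zero = begin
    punchIn p (prev Fin.zero)      ≡⟨ cong (λ q → punchIn q (prev Fin.zero)) p≡0 ⟩
    Fin.suc (prev Fin.zero)        ≡⟨ Finₚ.toℕ-injective (trans (cong suc toℕ-prev-0) (sym i≡last)) ⟩
    i                              ≡⟨ collapse-p (trans (Finₚ.toℕ-injective 0≡) (sym p≡0)) ⟨
    collapse (punchIn i Fin.zero)  ∎
    where
    open ≡-Reasoning
    toℕ-prev-0 : toℕ (prev {k} Fin.zero) ≡ k
    toℕ-prev-0 = trans (toℕ-prev Fin.zero) (m<n⇒m%n≡m (ℕₚ.n<1+n k))
    0≡ : toℕ (punchIn i Fin.zero) ≡ 0
    0≡ = toℕ-punchIn-below i Fin.zero (subst (0 ℕ.<_) (sym i≡last) (ℕ.s≤s ℕ.z≤n))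
  collapse-last p≡0 i≡last (Fin.suc j) = begin
    punchIn p (prev (Fin.suc j))   ≡⟨ cong (λ q → punchIn q (prev (Fin.suc j))) p≡0 ⟩
    Fin.suc (prev (Fin.suc j))     ≡⟨ Finₚ.toℕ-injective (cong suc toℕ-prev-suc) ⟩
    Fin.suc (Fin.inject₁ j)        ≡⟨ Finₚ.toℕ-injective (sym (trans below (cong suc (sym (Finₚ.toℕ-inject₁ j))))) ⟩
    punchIn i (Fin.suc j)          ≡⟨ collapse-other (λ e → ℕₚ.1+n≢0 (trans (sym below) (trans (cong toℕ e) (cong toℕ p≡0)))) ⟨
    collapse (punchIn i (Fin.suc j)) ∎
    where
    open ≡-Reasoning
    toℕ-prev-suc : toℕ (prev (Fin.suc j)) ≡ toℕ (Fin.inject₁ j)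
    toℕ-prev-suc = begin
      toℕ (prev (Fin.suc j))        ≡⟨ toℕ-prev (Fin.suc j) ⟩
      (suc (toℕ j) ℕ.+ k) % suc k   ≡⟨ cong (_% suc k) (sym (ℕₚ.+-suc (toℕ j) k)) ⟩
      (toℕ j ℕ.+ suc k) % suc k     ≡⟨ [m+n]%n≡m%n (toℕ j) (suc k) ⟩
      toℕ j % suc k                 ≡⟨ m<n⇒m%n≡m (ℕₚ.m<n⇒m<1+n (Finₚ.toℕ<n j)) ⟩
      toℕ j                         ≡⟨ Finₚ.toℕ-inject₁ j ⟨
      toℕ (Fin.inject₁ j)           ∎
    below : toℕ (punchIn i (Fin.suc j)) ≡ suc (toℕ j)
    below = toℕ-punchIn-below i (Fin.suc j) (subst (suc (toℕ j) ℕ.<_) (sym i≡last) (ℕ.s≤s (Finₚ.toℕ<n j)))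

  relabelling : Σ (Fin (suc k) ↔ Fin (suc k)) λ σ →
    (∀ j → Inverse.to σ (next j) ≡ next (Inverse.to σ j)) ×
    (∀ j → punchIn p (Inverse.to σ j) ≡ collapse (punchIn i j))
  relabelling with ℕₚ.m≤n⇒m<n∨m≡n (Finₚ.toℕ<n i)
  ... | inj₁ i+1<n = ↔-id (Fin (suc k)) , (λ _ → refl) ,
                     collapse-not-last (trans (toℕ-next i) (m<n⇒m%n≡m i+1<n))
  ... | inj₂ i+1≡n = mk↔ₛ′ prev next prev-next next-prev , (λ j → trans (prev-next j) (sym (next-prev j))) ,
                     collapse-last (Finₚ.toℕ-injective (trans (toℕ-next i) (trans (cong (_% suc (suc k)) i+1≡n) (n%n≡0 (suc (suc k))))))
                                   (ℕₚ.suc-injective i+1≡n)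

module Exchange {c ℓ : Level} (F : OrderedField c ℓ) (e : ℕ)
  (A : Fin (3 ℕ.+ suc e) → Geometry.Point F) (W : Fin (1 ℕ.+ suc e) → Geometry.Point F)
  (X : Geometry.TDiagram F (suc e) A W) (i : Fin (3 ℕ.+ suc e)) (b : Fin (1 ℕ.+ suc e))
  (adjacent : Geometry.AdjacentToSide F A (W b) i) where
  open import Level using (_⊔_)
  open import Data.Nat using (zero)
  open import Data.Product using (_×_; _,_; proj₁; proj₂)
  open import Data.Fin as Fin using (punchIn)
  import Data.Fin.Properties as Finₚ
  open import Data.Sum using (inj₁; inj₂)
  open import Data.Sum.Properties using (inj₁-injective)
  open import Data.Empty using (⊥-elim)
  open import Relation.Nullary using (¬_; Dec; yes; no)
  import Relation.Binary.PropositionalEquality as ≡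
  open ≡ using (_≡_; _≢_)
  open OrderedField F using (_<_; 0#)
  open Geometry F
  open PlaneGeometry F
  open TDiagram X
  open CyclicOrder
  open Relabelling i

  Black : Set
  Black = Fin (3 ℕ.+ suc e)

  clockwise : ∀ {u v w : Black} → CycOrd u v w → det (A u) (A v) (A w) < 0#
  clockwise (inj₁ (u<v , v<w))        = clockwiseConvex _ _ _ u<v v<w
  clockwise (inj₂ (inj₁ (v<w , w<u))) = rotate²-< (clockwiseConvex _ _ _ v<w w<u)
  clockwise (inj₂ (inj₂ (w<u , u<v))) = rotate-< (clockwiseConvex _ _ _ w<u u<v)

  q : Black
  q = next p

  -- B lies in each "ear" triangle A_i A_p A_y: it is right of A_i A_p
  -- (from the triangle A_i A_p A_q), of A_p A_y (from A_{i-1} A_i A_p) and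
  -- of A_y A_i (from A_i A_p A_q again).
  B-in-ear : ∀ y → y ≢ i → y ≢ p → InTriangle (A i) (A p) (A y) (W b)
  B-in-ear y y≢i y≢p = triangle-from-orientations _ _ _ (W b) (clockwise ipy) right-of-ip right-of-py right-of-yi
    where
    in-i⁻ip : InTriangle (A (prev i)) (A i) (A p) (W b)
    in-i⁻ip = proj₁ adjacent
    in-ipq : InTriangle (A i) (A p) (A q) (W b)
    in-ipq = proj₂ adjacent
    ipy : CycOrd i p y
    ipy = cyc-next i y y≢i y≢p
    right-of-ip : RightOf (A i) (A p) (W b)
    right-of-ip = triangle-right-of (A i) (A p) in-ipq (PQP-right _ _) (PQQ-right _ _)
      (inj₁ (clockwise (cyc-next i q (next²≢ i) (next≢ p))))
    i⁻ : Black
    i⁻ = prev i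
    right-of-py : RightOf (A p) (A y) (W b)
    right-of-py = triangle-right-of (A p) (A y) in-i⁻ip i⁻-right (inj₁ (clockwise (cyc-rotate ipy))) (PQP-right _ _)
      where
      i⁻-right : RightOf (A p) (A y) (A i⁻)
      i⁻-right with y Fin.≟ i⁻
      ... | yes ≡.refl = PQQ-right _ _
      ... | no y≢i⁻ = inj₁ (clockwise (cyc-rotate (≡.subst (λ v → CycOrd i⁻ (next v) y) (next-prev i)
            (cyc-next² i⁻ y y≢i⁻ (λ e → y≢i (≡.trans e (next-prev i)))
                               (λ e → y≢p (≡.trans e (≡.cong next (next-prev i))))))))
    right-of-yi : RightOf (A y) (A i) (W b)
    right-of-yi = triangle-right-of (A y) (A i) in-ipq (PQQ-right _ _) (inj₁ (clockwise (cyc-rotate (cyc-rotate ipy)))) q-right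
      where
      q-right : RightOf (A y) (A i) (A q)
      q-right with y Fin.≟ q
      ... | yes ≡.refl = PQP-right _ _
      ... | no y≢q = inj₁ (clockwise (cyc-rotate (cyc-rotate (cyc-next² i y y≢i y≢p y≢q))))

  -- since every black triangle contains exactly one white point, no other
  -- white point lies in an ear triangle
  ear-only-B : ∀ y → y ≢ i → y ≢ p → ∀ b′ → b′ ≢ b → ¬ InTriangle (A i) (A p) (A y) (W b′)
  ear-only-B y y≢i y≢p b′ b′≢b inside
    with uniqueWhite i p y (λ e → next≢ i (≡.sym e)) (λ e → y≢p (≡.sym e)) (λ e → y≢i (≡.sym e))
  ... | _ , _ , unique = b′≢b (≡.trans (unique b′ inside) (≡.sym (unique b (B-in-ear y y≢i y≢p))))

  -- In the convex quadrilateral A_i A_p A_y A_z, a white point other than B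
  -- moves between the triangles A_p A_y A_z and A_i A_y A_z: the other halves
  -- of the two triangulations are ear triangles.
  module _ {y z : Black} (pyz : CycOrd p y z) (y≢i : y ≢ i) (z≢i : z ≢ i) {b′} (b′≢b : b′ ≢ b) where
    private
      y≢p : y ≢ p
      y≢p e = cyc-distinct₁₂ pyz (≡.sym e)
      z≢p : z ≢ p
      z≢p = cyc-distinct₃₁ pyz
      open ConvexQuadrilateral (clockwise (cyc-next i y y≢i y≢p)) (clockwise (cyc-next i z z≢i z≢p))
                               (clockwise (cyc-unshift pyz y≢i z≢i)) (clockwise pyz)

    move-to-i : InTriangle (A p) (A y) (A z) (W b′) → InTriangle (A i) (A y) (A z) (W b′)
    move-to-i h with split-pyz h
    ... | inj₁ in-ear = ⊥-elim (ear-only-B y y≢i y≢p b′ b′≢b in-ear)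
    ... | inj₂ in-iyz = in-iyz

    move-to-p : InTriangle (A i) (A y) (A z) (W b′) → InTriangle (A p) (A y) (A z) (W b′)
    move-to-p h with split-ayz h
    ... | inj₁ in-ear = ⊥-elim (ear-only-B z z≢i z≢p b′ b′≢b in-ear)
    ... | inj₂ in-pyz = in-pyz

  -- Index families whose hulls are compared: injective and cyclically ordered,
  -- like the consecutive black points of a smaller diagram.
  record Admissible {l : ℕ} (g : Fin l → Black) : Set where
    field
      injective : ∀ t t′ → g t ≡ g t′ → t ≡ t′
      ordered   : ∀ t₁ t₂ t₃ → t₁ Fin.< t₂ → t₂ Fin.< t₃ → CycOrd (g t₁) (g t₂) (g t₃)

  open Admissible

  cyc-resp : ∀ {u v w u′ v′ w′ : Black} → u ≡ u′ → v ≡ v′ → w ≡ w′ → CycOrd u v w → CycOrd u′ v′ w′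
  cyc-resp ≡.refl ≡.refl ≡.refl c = c

  -- away from i, collapse only replaces p by i, which keeps the cyclic order
  collapse-cyc : ∀ {u v w} → CycOrd u v w → u ≢ i → v ≢ i → w ≢ i →
    CycOrd (collapse u) (collapse v) (collapse w)
  collapse-cyc {u} {v} {w} uvw u≢i v≢i w≢i = by-cases (u Fin.≟ p) (v Fin.≟ p) (w Fin.≟ p)
    where
    by-cases : Dec (u ≡ p) → Dec (v ≡ p) → Dec (w ≡ p) → CycOrd (collapse u) (collapse v) (collapse w)
    by-cases (yes u≡p) _ _ =
      cyc-resp (≡.sym (collapse-p u≡p)) (≡.sym (collapse-other (λ e → cyc-distinct₁₂ uvw (≡.trans u≡p (≡.sym e)))))
               (≡.sym (collapse-other (λ e → cyc-distinct₃₁ uvw (≡.trans e (≡.sym u≡p)))))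
               (cyc-unshift (≡.subst (λ x → CycOrd x v w) u≡p uvw) v≢i w≢i)
    by-cases (no u≢p) (yes v≡p) _ =
      cyc-resp (≡.sym (collapse-other u≢p)) (≡.sym (collapse-p v≡p))
               (≡.sym (collapse-other (λ e → cyc-distinct₁₂ (cyc-rotate uvw) (≡.trans v≡p (≡.sym e)))))
               (cyc-rotate (cyc-rotate (cyc-unshift (≡.subst (λ x → CycOrd x w u) v≡p (cyc-rotate uvw)) w≢i u≢i)))
    by-cases (no u≢p) (no v≢p) (yes w≡p) =
      cyc-resp (≡.sym (collapse-other u≢p)) (≡.sym (collapse-other v≢p)) (≡.sym (collapse-p w≡p))
               (cyc-rotate (cyc-unshift (≡.subst (λ x → CycOrd x u v) w≡p (cyc-rotate (cyc-rotate uvw))) u≢i v≢i))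
    by-cases (no u≢p) (no v≢p) (no w≢p) =
      cyc-resp (≡.sym (collapse-other u≢p)) (≡.sym (collapse-other v≢p)) (≡.sym (collapse-other w≢p)) uvw

  collapse-injective : ∀ {u v} → u ≢ i → v ≢ i → collapse u ≡ collapse v → u ≡ v
  collapse-injective {u} {v} u≢i v≢i eq = by-cases (u Fin.≟ p) (v Fin.≟ p)
    where
    by-cases : Dec (u ≡ p) → Dec (v ≡ p) → u ≡ v
    by-cases (yes u≡p) (yes v≡p) = ≡.trans u≡p (≡.sym v≡p)
    by-cases (yes u≡p) (no v≢p)  = ⊥-elim (v≢i (≡.trans (≡.sym (collapse-other v≢p)) (≡.trans (≡.sym eq) (collapse-p u≡p))))
    by-cases (no u≢p)  (yes v≡p) = ⊥-elim (u≢i (≡.trans (≡.sym (collapse-other u≢p)) (≡.trans eq (collapse-p v≡p))))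
    by-cases (no u≢p)  (no v≢p)  = ≡.trans (≡.sym (collapse-other u≢p)) (≡.trans eq (collapse-other v≢p))

  collapse-admissible : ∀ {l} {g : Fin l → Black} → Admissible g → (∀ t → g t ≢ i) →
    Admissible (λ t → collapse (g t))
  collapse-admissible adm avoid = record
    { injective = λ t t′ eq → injective adm t t′ (collapse-injective (avoid t) (avoid t′) eq)
    ; ordered   = λ t₁ t₂ t₃ t₁<t₂ t₂<t₃ →
        collapse-cyc (ordered adm t₁ t₂ t₃ t₁<t₂ t₂<t₃) (avoid t₁) (avoid t₂) (avoid t₃)
    }

  convex : ∀ {l} {g : Fin l → Black} → Admissible g → ClockwiseConvex (λ t → A (g t))
  convex adm t₁ t₂ t₃ t₁<t₂ t₂<t₃ = clockwise (ordered adm t₁ t₂ t₃ t₁<t₂ t₂<t₃)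

  white-not-on-black : ∀ (g : Fin 1 → Black) b′ → ¬ InHull (λ t → A (g t)) (W b′)
  white-not-on-black g b′ h = generalPosition (inj₁ x) (inj₁ (next x)) (inj₂ b′)
    (λ e → next≢ x (≡.sym (inj₁-injective e))) (λ ()) (λ ())
    (hull-on-line {R = λ t → A (g t)} (A x) (A (next x)) h (λ { Fin.zero → det-PQP _ _ }))
    where x = g Fin.zero

  white-not-on-segment : ∀ (g : Fin 2 → Black) → (∀ t t′ → g t ≡ g t′ → t ≡ t′) → ∀ b′ →
    ¬ InHull (λ t → A (g t)) (W b′)
  white-not-on-segment g g-injective b′ h = generalPosition (inj₁ x) (inj₁ y) (inj₂ b′)
    (λ e → 0≢1 (g-injective _ _ (inj₁-injective e))) (λ ()) (λ ())
    (hull-on-line {R = λ t → A (g t)} (A x) (A y) h (λ { Fin.zero → det-PQP _ _ ; (Fin.suc Fin.zero) → det-PQQ _ _ }))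
    where
    x = g Fin.zero
    y = g (Fin.suc Fin.zero)
    0≢1 : Fin.zero ≢ Fin.suc Fin.zero
    0≢1 ()

  -- A vertex triangle of an admissible family either avoids p, or, rotated,
  -- starts at p (the family g indexes the triangle's vertices; S may be any
  -- point family, e.g. A ∘ g or A ∘ collapse ∘ g).
  data TriangleCase {l} (g : Fin l → Black) (S : Fin l → Point) (Z : Point) : Set (c ⊔ ℓ) where
    avoids-p  : ∀ u v w → g u ≢ p → g v ≢ p → g w ≢ p → InTriangle (S u) (S v) (S w) Z → TriangleCase g S Z
    through-p : ∀ u v w → g u ≡ p → CycOrd p (g v) (g w) → InTriangle (S u) (S v) (S w) Z → TriangleCase g S Z

  triangle-case : ∀ {l} {g : Fin l → Black} {S Z} → Admissible g → InVertexTriangle S Z → TriangleCase g S Z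
  triangle-case {g = g} adm (vertexTriangle u v w u<v v<w inside)
    with g u Fin.≟ p | g v Fin.≟ p | g w Fin.≟ p
  ... | yes gu≡p | _ | _ = through-p u v w gu≡p (≡.subst (λ x → CycOrd x (g v) (g w)) gu≡p uvw) inside
    where uvw = ordered adm u v w u<v v<w
  ... | no _ | yes gv≡p | _ = through-p v w u gv≡p
          (≡.subst (λ x → CycOrd x (g w) (g u)) gv≡p (cyc-rotate (ordered adm u v w u<v v<w)))
          (triangle-rotate inside)
  ... | no _ | no _ | yes gw≡p = through-p w u v gw≡p
          (≡.subst (λ x → CycOrd x (g u) (g v)) gw≡p (cyc-rotate (cyc-rotate (ordered adm u v w u<v v<w))))
          (triangle-rotate (triangle-rotate inside))
  ... | no gu≢p | no gv≢p | no gw≢p = avoids-p u v w gu≢p gv≢p gw≢p inside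

  -- For a white point other than B, replacing p by i does not change
  -- membership in the hull of an admissible family avoiding i: transport a
  -- vertex triangle containing the point, moving it with move-to-i / move-to-p
  -- when p is a vertex.
  module _ {l} {g : Fin l → Black} (avoid : ∀ t → g t ≢ i) {b′} (b′≢b : b′ ≢ b) where
    private
      fixed : ∀ {x} → x ≢ p → A x ≡ A (collapse x)
      fixed x≢p = ≡.cong A (≡.sym (collapse-other x≢p))

    from-triangle : TriangleCase g (λ t → A (g t)) (W b′) → InHull (λ t → A (collapse (g t))) (W b′)
    from-triangle (avoids-p u v w gu≢p gv≢p gw≢p inside) =
      triangle⇒hull _ u v w (triangle-cong (fixed gu≢p) (fixed gv≢p) (fixed gw≢p) inside)
    from-triangle (through-p u v w gu≡p pvw inside) =
      triangle⇒hull _ u v w (triangle-cong (≡.cong A (≡.sym (collapse-p gu≡p)))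
        (fixed (λ e → cyc-distinct₁₂ pvw (≡.sym e))) (fixed (cyc-distinct₃₁ pvw))
        (move-to-i pvw (avoid v) (avoid w) b′≢b (triangle-cong (≡.cong A gu≡p) ≡.refl ≡.refl inside)))

    from-collapsed-triangle : TriangleCase g (λ t → A (collapse (g t))) (W b′) → InHull (λ t → A (g t)) (W b′)
    from-collapsed-triangle (avoids-p u v w gu≢p gv≢p gw≢p inside) =
      triangle⇒hull _ u v w (triangle-cong (≡.sym (fixed gu≢p)) (≡.sym (fixed gv≢p)) (≡.sym (fixed gw≢p)) inside)
    from-collapsed-triangle (through-p u v w gu≡p pvw inside) =
      triangle⇒hull _ u v w (triangle-cong (≡.cong A (≡.sym gu≡p)) ≡.refl ≡.refl
        (move-to-p pvw (avoid v) (avoid w) b′≢b (triangle-cong (≡.cong A (collapse-p gu≡p))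
          (≡.sym (fixed (λ e → cyc-distinct₁₂ pvw (≡.sym e)))) (≡.sym (fixed (cyc-distinct₃₁ pvw))) inside)))

  -- Hulls of at most two black points contain no white point; larger hulls
  -- are convex polygons whose points lie in vertex triangles.
  hull-transfer : ∀ l (g : Fin l → Black) → Admissible g → (∀ t → g t ≢ i) → ∀ {b′} → b′ ≢ b →
    (InHull (λ t → A (g t)) (W b′) → InHull (λ t → A (collapse (g t))) (W b′)) ×
    (InHull (λ t → A (collapse (g t))) (W b′) → InHull (λ t → A (g t)) (W b′))
  hull-transfer zero g _ _ _ =
    (λ h → ⊥-elim (empty-hull {R = λ t → A (g t)} h)) , (λ h → ⊥-elim (empty-hull {R = λ t → A (collapse (g t))} h))
  hull-transfer (suc zero) g _ _ {b′} _ =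
    (λ h → ⊥-elim (white-not-on-black g b′ h)) , (λ h → ⊥-elim (white-not-on-black (λ t → collapse (g t)) b′ h))
  hull-transfer (suc (suc zero)) g adm avoid {b′} _ =
    (λ h → ⊥-elim (white-not-on-segment g (injective adm) b′ h)) ,
    (λ h → ⊥-elim (white-not-on-segment (λ t → collapse (g t)) (injective (collapse-admissible adm avoid)) b′ h))
  hull-transfer (suc (suc (suc n))) g adm avoid b′≢b =
    (λ h → from-triangle avoid b′≢b
             (triangle-case adm (hull⇒vertex-triangle n _ (convex adm) h))) ,
    (λ h → from-collapsed-triangle avoid b′≢b
             (triangle-case adm (hull⇒vertex-triangle n _ (convex (collapse-admissible adm avoid)) h)))

  Reduced : Set
  Reduced = Fin (3 ℕ.+ e)

  consecutive-admissible : ∀ (s : Reduced) l → l ℕ.≤ 3 ℕ.+ e → Admissible (λ t → punchIn i (consec s l t))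
  consecutive-admissible s l l≤ = record
    { injective = λ t t′ eq → consec-injective s l l≤ t t′ (Finₚ.punchIn-injective i _ _ eq)
    ; ordered   = λ t₁ t₂ t₃ t₁<t₂ t₂<t₃ →
        cyc-map (punchIn i) (PunchIn.punchIn-< i) (cyc-consec s l l≤ t₁ t₂ t₃ t₁<t₂ t₂<t₃)
    }

  consecutive-hulls : (σ : Reduced → Reduced) → (∀ j → punchIn p (σ j) ≡ collapse (punchIn i j)) →
    ∀ (s : Reduced) l → l ℕ.≤ 3 ℕ.+ e → ∀ (b″ : Fin (1 ℕ.+ e)) →
    (InHull (λ t → A (punchIn i (consec s l t))) (W (punchIn b b″))
       → InHull (λ t → A (punchIn p (σ (consec s l t)))) (W (punchIn b b″)))
    × (InHull (λ t → A (punchIn p (σ (consec s l t)))) (W (punchIn b b″))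
       → InHull (λ t → A (punchIn i (consec s l t))) (W (punchIn b b″)))
  consecutive-hulls σ σ-collapses s l l≤ b″ =
    (λ h → hull-cong relabel (proj₁ transfer h)) ,
    (λ h → proj₂ transfer (hull-cong (λ t → ≡.sym (relabel t)) h))
    where
    g : Fin l → Black
    g t = punchIn i (consec s l t)
    transfer = hull-transfer l g (consecutive-admissible s l l≤) (λ t → Finₚ.punchInᵢ≢i i _) (Finₚ.punchInᵢ≢i b b″)
    relabel : ∀ t → A (collapse (g t)) ≡ A (punchIn p (σ (consec s l t)))
    relabel t = ≡.cong A (≡.sym (σ-collapses (consec s l t)))

open import Data.Nat using (ℕ; suc; _+_)
open import Data.Fin using (Fin; punchIn)
open import Data.Product using (_,_)
open import Data.Sum using (inj₁)
open import Function.Bundles using (Inverse)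
open import Function.Construct.Identity using (↔-id)

-- The relabelling σ of black points is a rotation, the white points are
-- matched identically, and the hull condition holds for every set of
-- consecutive black points.
proposition3p10 : ∀ {c ℓ : Level} (F : OrderedField c ℓ) (e : ℕ)
    (A : Fin (3 + suc e) → Geometry.Point F) (W : Fin (1 + suc e) → Geometry.Point F) →
    Geometry.TDiagram F (suc e) A W →
    (i : Fin (3 + suc e)) (b : Fin (1 + suc e)) →
    Geometry.AdjacentToSide F A (W b) i →
    Geometry.EquivByDiagonals F
      (λ j → A (punchIn i j)) (λ j → W (punchIn b j))
      (λ j → A (punchIn (next i) j)) (λ j → W (punchIn b j))
proposition3p10 F e A W X i b adjacent with Relabelling.relabelling i
... | σ , σ-rotates , σ-collapses =
  σ , ↔-id _ , inj₁ σ-rotates ,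
  Exchange.consecutive-hulls F e A W X i b adjacent (Inverse.to σ) σ-collapses
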